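{- Let $k$ be a field and let $W\colon\mathbb{Z}^2\to\mathbb{Z}$ be a perfect matching with associated bijection $\pi$. Let $\mathbf{d}=(d_1,d_2)\in\mathbb{Z}^2$. Then: (1) $b^0(\mathcal{M}_{W,\mathbf{d}})$ equals the number of $\mathbf{a}\in\mathbb{Z}^2$ with $W(\mathbf{a})=1$ and $\mathbf{a}\le\mathbf{d}$; hence $f(\mathbf{d}):=b^0(\mathcal{M}_{W,\mathbf{d}})=(\mathfrak{s}W)(\mathbf{d})$. (2) More precisely, $H^0(\mathcal{M}_{W,\mathbf{d}})=\ker(\partial)$ has a basis consisting of the elements whose $B_1$-component is $\mathbf{e}_{a_1}$, whose $B_3$-component is the basis vector indexed by $(a_1,a_2,1)$, and whose $B_2$-component is $\mathbf{e}_{a_2}$, ranging over all $\mathbf{a}=(a_1,a_2)$ with $W(\mathbf{a})=1$ and $\mathbf{a}\le\mathbf{d}$. (3) $b^1(\mathcal{M}_{W,\mathbf{d}})$ equals the number of $\mathbf{a}\in\mathbb{Z}^2$ with $W(\mathbf{a})=1$ and $\mathbf{a}\ge\mathbf{d}+\mathbf{1}$, where $\mathbf{1}=(1,1)$. (4) More precisely, $H^1(\mathcal{M}_{W,\mathbf{d}})$ has a basis consisting of the images of the elements $(\mathbf{e}_{a_1},0)\in\mathcal{M}_{W,\mathbf{d}}(A_1)\oplus\mathcal{M}_{W,\mathbf{d}}(A_2)$ ranging over $a_1$ with $a_1\ge d_1+1$ and $a_2:=\pi(a_1)\ge d_2+1$. In particular, $b^i(\mathcal{M}_{W,\mathbf{d}})$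 is finite for $i=0,1$ and all $\mathbf{d}$, it is zero when $i=0$ and $\deg(\mathbf{d})$ is sufficiently small and when $i=1$ and $\deg(\mathbf{d})$ is sufficiently large; there is $C\in\mathbb{Z}$, namely $C=\chi(\mathcal{M}_{W,\mathbf{0}})$, with $\chi(\mathcal{M}_{W,\mathbf{d}})=\deg(\mathbf{d})+C$ for all $\mathbf{d}$; and for any $\mathbf{K}\in\mathbb{Z}^2$ and $\mathbf{L}=\mathbf{K}+\mathbf{1}$, $$b^1(\mathcal{M}_{W,\mathbf{d}})=f^\wedge_{\mathbf{K}}(\mathbf{K}-\mathbf{d})=(\mathfrak{s}W^*_{\mathbf{L}})(\mathbf{K}-\mathbf{d}).$$
   Context: For $\mathbf{d}\in\mathbb{Z}^n$, $\deg(\mathbf{d})=d_1+\cdots+d_n$; $\mathbb{Z}^n$ has the componentwise partial order. A function $g\colon\mathbb{Z}^n\to\mathbb{Z}$ is initially (resp. eventually) zero if $g(\mathbf{d})=0$ whenever $\deg(\mathbf{d})$ is sufficiently small (resp. large). A perfect matching is an initially and eventually zero $W\colon\mathbb{Z}^2\to\mathbb{Z}$ for which there is a bijection $\pi\colon\mathbb{Z}\to\mathbb{Z}$ (the associated bijection) with $W(i,j)=1$ if $j=\pi(i)$ and $W(i,j)=0$ otherwise. For initially zero $W$, $(\mathfrak{s}W)(\mathbf{d})=\sum_{\mathbf{d}'\le\mathbf{d}}W(\mathbf{d}')$, and $W^*_{\mathbf{L}}(\mathbf{d})=W(\mathbf{L}-\mathbf{d})$. A Riemann function is $f\colon\mathbb{Z}^n\to\mathbb{Z}$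 such that for some $C,a,b\in\mathbb{Z}$, $f(\mathbf{d})=0$ if $\deg(\mathbf{d})\le a$ and $f(\mathbf{d})=\deg(\mathbf{d})+C$ if $\deg(\mathbf{d})\ge b$; $C$ is its offset. For $\mathbf{K}\in\mathbb{Z}^n$, $f^\wedge_{\mathbf{K}}(\mathbf{d})=f(\mathbf{K}-\mathbf{d})-\deg(\mathbf{K}-\mathbf{d})-C$. A $k$-diagram $\mathcal{F}$ consists of $k$-vector spaces $\mathcal{F}(B_1),\mathcal{F}(B_2),\mathcal{F}(B_3),\mathcal{F}(A_1),\mathcal{F}(A_2)$ and linear maps $\rho_{1,1}\colon\mathcal{F}(B_1)\to\mathcal{F}(A_1)$, $\rho_{2,2}\colon\mathcal{F}(B_2)\to\mathcal{F}(A_2)$, $\rho_{3,1}\colon\mathcal{F}(B_3)\to\mathcal{F}(A_1)$, $\rho_{3,2}\colon\mathcal{F}(B_3)\to\mathcal{F}(A_2)$. Its differential $\partial\colon\mathcal{F}(B_1)\oplus\mathcal{F}(B_2)\oplus\mathcal{F}(B_3)\to\mathcal{F}(A_1)\oplus\mathcal{F}(A_2)$ is $(b_1,b_2,b_3)\mapsto(\rho_{1,1}b_1-\rho_{3,1}b_3,\ \rho_{2,2}b_2-\rho_{3,2}b_3)$; $H^0(\mathcal{F})=\ker\partial$, $H^1(\mathcal{F})=\operatorname{coker}\partial$, $b^i=\dim_k H^i$, $\chi=b^0-b^1$. For $W\colon\mathbb{Z}^2\to\mathbb{Z}_{\ge0}\cup\{\infty\}$ let $\mathrm{Multi}(W)=\{(s_1,s_2,i)\in\mathbb{Z}^2\times\mathbb{N}: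 i\le W(s_1,s_2)\}$. For a set $S$, $k^{\oplus S}$ is the vector space with basis $\{\mathbf{e}_s\}_{s\in S}$. The $k$-diagram $\mathcal{M}_{W,\mathbf{d}}$ has $\mathcal{M}_{W,\mathbf{d}}(B_i)=k^{\oplus\mathbb{Z}_{\le d_i}}$, $\mathcal{M}_{W,\mathbf{d}}(A_i)=k^{\oplus\mathbb{Z}}$ ($i=1,2$) with $\rho_{i,i}$ the inclusions, $\mathcal{M}_{W,\mathbf{d}}(B_3)=k^{\oplus\mathrm{Multi}(W)}$, and $\rho_{3,j}$ sending the basis vector of $(s_1,s_2,i)$ to $\mathbf{e}_{s_j}$. -}

module Defs where

open import Level using (_⊔_) renaming (suc to lsuc)
open import Algebra.Bundles using (CommutativeRing)
open import Data.Integer using (ℤ; +_; 0ℤ; 1ℤ) renaming (_+_ to _+ℤ_; _-_ to _-ℤ_; _≤_ to _≤ℤ_)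
import Data.Integer.Properties as ℤP
open import Data.Nat using (ℕ; s≤s; z≤n) renaming (_≤_ to _≤ℕ_)
import Data.Nat.Properties as ℕP
open import Data.Fin using (Fin)
open import Data.Bool using (if_then_else_)
open import Data.Product using (Σ; ∃-syntax; _×_; _,_; proj₁; proj₂)
import Data.Product.Properties as ×P
open import Data.List using (List; []; _∷_; _++_; map; concatMap; sum; allFin)
open import Data.List.Relation.Unary.All using (All)
open import Data.List.Relation.Unary.Unique.Propositional using (Unique)
open import Data.List.Membership.Propositional using (_∈_)
open import Relation.Binary.PropositionalEquality using (_≡_; refl; cong; cong₂; subst; sym)
open import Relation.Binary.Definitions using (DecidableEquality)
open import Relation.Nullary using (¬_; yes; no; does)
open import Relation.Nullary.Irrelevant using (Irrelevant)
open import Function.Definitions using (Injective; Bijective)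

Pt : Set
Pt = ℤ × ℤ

deg : Pt → ℤ
deg (a , b) = a +ℤ b

_⊕_ : Pt → Pt → Pt
(a , b) ⊕ (c , d) = (a +ℤ c , b +ℤ d)

_⊖_ : Pt → Pt → Pt
(a , b) ⊖ (c , d) = (a -ℤ c , b -ℤ d)

𝟎 : Pt
𝟎 = (0ℤ , 0ℤ)

𝟏 : Pt
𝟏 = (1ℤ , 1ℤ)

_≤P_ : Pt → Pt → Set
(a , b) ≤P (c , d) = (a ≤ℤ c) × (b ≤ℤ d)

InitiallyZero : (Pt → ℤ) → Set
InitiallyZero g = ∃[ a ] (∀ d → deg d ≤ℤ a → g d ≡ 0ℤ)

EventuallyZero : (Pt → ℤ) → Set
EventuallyZero g = ∃[ b ] (∀ d → b ≤ℤ deg d → g d ≡ 0ℤ)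

IsPerfectMatching : (Pt → ℤ) → (ℤ → ℤ) → Set
IsPerfectMatching W π =
  InitiallyZero W × EventuallyZero W × Bijective _≡_ _≡_ π ×
  (∀ i j → (j ≡ π i → W (i , j) ≡ 1ℤ) × (¬ (j ≡ π i) → W (i , j) ≡ 0ℤ))

dual : Pt → (Pt → ℤ) → Pt → ℤ
dual L W d = W (L ⊖ d)

-- (𝔰 W)(d) = m : the (finitely supported) sum of W(d') over d' ≤ d is m.
-- Witnessed by a duplicate-free list of points ≤ d containing every
-- d' ≤ d with W d' ≠ 0.
SumBelow : (Pt → ℤ) → Pt → ℤ → Set
SumBelow W d m = ∃[ L ] (Unique L × All (λ p → p ≤P d) L ×
  (∀ p → p ≤P d → ¬ (W p ≡ 0ℤ) → p ∈ L) ×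
  Data.List.foldr _+ℤ_ 0ℤ (map W L) ≡ m)

-- e : Fin n → A enumerates the set {a | P a} without repetition
-- (so that this set has exactly n elements).
Enumerates : {A : Set} → (A → Set) → (n : ℕ) → (Fin n → A) → Set
Enumerates P n e = (∀ i → P (e i)) × Injective _≡_ _≡_ e × (∀ a → P a → ∃[ i ] (e i ≡ a))

record Field c ℓ : Set (lsuc (c ⊔ ℓ)) where
  field
    commutativeRing : CommutativeRing c ℓ
  open CommutativeRing commutativeRing public
  field
    nontrivial : ¬ (1# ≈ 0#)
    inverse    : ∀ x → ¬ (x ≈ 0#) → ∃[ y ] (x * y ≈ 1#)

-- Index sets with decidable equality (bases of k^{⊕S})

record Based : Set₁ where
  field
    Idx : Set
    _≟_ : DecidableEquality Idx
open Based public

Σ-≟ : {A : Set} {P : A → Set} → DecidableEquality A → (∀ a → Irrelevant (P a)) →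
      DecidableEquality (Σ A P)
Σ-≟ eq irr (a , p) (b , q) with eq a b
... | yes refl = yes (cong (a ,_) (irr a p q))
... | no ne = no (λ e → ne (cong proj₁ e))

×-irr : {P Q : Set} → Irrelevant P → Irrelevant Q → Irrelevant (P × Q)
×-irr ip iq (a , b) (c , d) = cong₂ _,_ (ip a c) (iq b d)

ℤ-based : Based
ℤ-based = record { Idx = ℤ ; _≟_ = ℤP._≟_ }

ℤ≤-based : ℤ → Based
ℤ≤-based m = record { Idx = Σ ℤ (λ s → s ≤ℤ m) ; _≟_ = Σ-≟ ℤP._≟_ (λ _ → ℤP.≤-irrelevant) }

-- Multi(W) = {(s₁,s₂,i) ∈ ℤ² × ℕ | i ≤ W(s₁,s₂)}, with ℕ = {1,2,...}
MultiPred : (Pt → ℤ) → ℤ × ℤ × ℕ → Set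
MultiPred W (s₁ , s₂ , i) = (1 ≤ℕ i) × (+ i ≤ℤ W (s₁ , s₂))

Multi-based : (Pt → ℤ) → Based
Multi-based W = record
  { Idx = Σ (ℤ × ℤ × ℕ) (MultiPred W)
  ; _≟_ = Σ-≟ (×P.≡-dec ℤP._≟_ (×P.≡-dec ℤP._≟_ ℕP._≟_))
              (λ _ → ×-irr ℕP.≤-irrelevant ℤP.≤-irrelevant) }

module LinAlg {c ℓ} (F : Field c ℓ) where
  open Field F using (Carrier; _≈_; _+_; _*_; -_; 0#; 1#)

  -- an element of k^{⊕S}: a finite formal linear combination
  V : Based → Set c
  V S = List (Idx S × Carrier)

  coeff : (S : Based) → V S → Idx S → Carrier
  coeff S [] t = 0#
  coeff S ((s , a) ∷ l) t = (if does ((S ._≟_) s t) then a else 0#) + coeff S l t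

  Eq : (S : Based) → V S → V S → Set ℓ
  Eq S x y = ∀ t → coeff S x t ≈ coeff S y t

  e[_∣_] : (S : Based) → Idx S → V S
  e[ S ∣ s ] = (s , 1#) ∷ []

  scale : (S : Based) → Carrier → V S → V S
  scale S a = map (λ p → (proj₁ p , a * proj₂ p))

  ext : (S T : Based) → (Idx S → V T) → V S → V T
  ext S T f [] = []
  ext S T f ((s , a) ∷ l) = scale T a (f s) ++ ext S T f l

  lc : (S : Based) {n : ℕ} → (Fin n → Carrier) → (Fin n → V S) → V S
  lc S {n} c v = concatMap (λ i → scale S (c i) (v i)) (allFin n)

  -- k-diagrams (all spaces given as k^{⊕S}, maps given on basis vectors)
  record KDiagram : Set (lsuc c) where
    field
      B₁ B₂ B₃ A₁ A₂ : Based
      ρ₁₁ : Idx B₁ → V A₁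
      ρ₂₂ : Idx B₂ → V A₂
      ρ₃₁ : Idx B₃ → V A₁
      ρ₃₂ : Idx B₃ → V A₂

  module _ (D : KDiagram) where
    open KDiagram D

    Dom : Set c
    Dom = V B₁ × V B₂ × V B₃

    Cod : Set c
    Cod = V A₁ × V A₂

    _≈D_ : Dom → Dom → Set ℓ
    (x₁ , x₂ , x₃) ≈D (y₁ , y₂ , y₃) = Eq B₁ x₁ y₁ × Eq B₂ x₂ y₂ × Eq B₃ x₃ y₃

    _≈C_ : Cod → Cod → Set ℓ
    (x₁ , x₂) ≈C (y₁ , y₂) = Eq A₁ x₁ y₁ × Eq A₂ x₂ y₂

    0D : Dom
    0D = ([] , [] , [])

    0C : Cod
    0C = ([] , [])

    _+C_ : Cod → Cod → Cod
    (x₁ , x₂) +C (y₁ , y₂) = (x₁ ++ y₁ , x₂ ++ y₂)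

    lcD : {n : ℕ} → (Fin n → Carrier) → (Fin n → Dom) → Dom
    lcD c v = (lc B₁ c (λ i → proj₁ (v i)) , lc B₂ c (λ i → proj₁ (proj₂ (v i))) , lc B₃ c (λ i → proj₂ (proj₂ (v i))))

    lcC : {n : ℕ} → (Fin n → Carrier) → (Fin n → Cod) → Cod
    lcC c v = (lc A₁ c (λ i → proj₁ (v i)) , lc A₂ c (λ i → proj₂ (v i)))

    ∂ : Dom → Cod
    ∂ (b₁ , b₂ , b₃) = ( ext B₁ A₁ ρ₁₁ b₁ ++ scale A₁ (- 1#) (ext B₃ A₁ ρ₃₁ b₃)
                       , ext B₂ A₂ ρ₂₂ b₂ ++ scale A₂ (- 1#) (ext B₃ A₂ ρ₃₂ b₃) )

    InH⁰ : Dom → Set ℓ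
    InH⁰ x = ∂ x ≈C 0C

    IsH⁰Basis : (n : ℕ) → (Fin n → Dom) → Set (c ⊔ ℓ)
    IsH⁰Basis n v =
      (∀ i → InH⁰ (v i)) ×
      (∀ a → lcD a v ≈D 0D → ∀ i → a i ≈ 0#) ×
      (∀ x → InH⁰ x → ∃[ a ] (x ≈D lcD a v))

    -- the images of u in H¹ = coker ∂ form a basis of H¹
    IsH¹Basis : (n : ℕ) → (Fin n → Cod) → Set (c ⊔ ℓ)
    IsH¹Basis n u =
      (∀ a x → lcC a u ≈C ∂ x → ∀ i → a i ≈ 0#) ×
      (∀ y → ∃[ a ] ∃[ x ] (y ≈C (lcC a u +C ∂ x)))

    b⁰≡ : ℕ → Set (c ⊔ ℓ)
    b⁰≡ n = ∃[ v ] IsH⁰Basis n v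

    b¹≡ : ℕ → Set (c ⊔ ℓ)
    b¹≡ n = ∃[ u ] IsH¹Basis n u

  M : (Pt → ℤ) → Pt → KDiagram
  M W (d₁ , d₂) = record
    { B₁ = ℤ≤-based d₁ ; B₂ = ℤ≤-based d₂ ; B₃ = Multi-based W
    ; A₁ = ℤ-based ; A₂ = ℤ-based
    ; ρ₁₁ = λ s → e[ ℤ-based ∣ proj₁ s ]
    ; ρ₂₂ = λ s → e[ ℤ-based ∣ proj₁ s ]
    ; ρ₃₁ = λ t → e[ ℤ-based ∣ proj₁ (proj₁ t) ]
    ; ρ₃₂ = λ t → e[ ℤ-based ∣ proj₁ (proj₂ (proj₁ t)) ] }

  h⁰vec : (W : Pt → ℤ) (d : Pt) (a : Pt) → W a ≡ 1ℤ → a ≤P d → Dom (M W d)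
  h⁰vec W (d₁ , d₂) (a₁ , a₂) w (le₁ , le₂) =
    ( e[ ℤ≤-based d₁ ∣ (a₁ , le₁) ] , e[ ℤ≤-based d₂ ∣ (a₂ , le₂) ]
    , e[ Multi-based W ∣ ((a₁ , a₂ , 1) , (s≤s z≤n , subst (λ z → + 1 ≤ℤ z) (sym w) ℤP.≤-refl)) ] )

  h¹vec : (W : Pt → ℤ) (d : Pt) → ℤ → Cod (M W d)
  h¹vec W (d₁ , d₂) a₁ = (e[ ℤ-based ∣ a₁ ] , [])

{-# OPTIONS --safe #-}
-- Since W is the graph of π with multiplicity one, Multi(W) is a copy of ℤ and the
-- differential ∂ of M_{W,d} can be read off coefficientwise.  A kernel element is
-- determined by its B₃-coefficients at the graph points (u, π u), which must vanish
-- unless u ≤ d₁ and π u ≤ d₂; a class in the cokernel is, modulo im ∂, a combination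
-- of the e_{a₁} with a₁ > d₁ and π a₁ > d₂, detected by y ↦ y₁(a₁) - y₂(π a₁).
-- Dimensions are well defined because a wide matrix over a field has a nonzero
-- kernel vector.  Raising d₁ or d₂ by one moves exactly one graph point, either
-- into the box counted by b⁰ or out of the one counted by b¹, so χ grows by one;
-- the duality formulas reflect the count for b¹ through K + 1.

module Submission where

open import Defs
open import Level using (_⊔_)
open import Data.Bool using (true; false; if_then_else_)
open import Data.Nat as ℕ using (ℕ; zero; suc; s≤s; z≤n)
import Data.Nat.Properties as ℕP
open import Data.Integer as ℤ using (ℤ; +_; -[1+_]; 0ℤ; 1ℤ)
  renaming (_+_ to _+ℤ_; _-_ to _-ℤ_; _≤_ to _≤ℤ_; _<_ to _<ℤ_)
import Data.Integer.Properties as ℤP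
open import Data.Integer.Solver using (module +-*-Solver)
open +-*-Solver using (solve; _:=_; con; _:+_; _:-_; :-_)
open import Data.Fin as Fin using (Fin; zero; suc; punchIn)
import Data.Fin.Properties as FinP
open import Data.Vec.Functional using (insertAt) renaming (_∷_ to _◂_)
open import Data.Vec.Functional.Properties using (insertAt-lookup; insertAt-punchIn)
open import Data.List using ([]; _∷_; _++_; map; concatMap; tabulate; foldr)
import Data.List.Properties as ListP
import Data.List.Relation.Unary.All.Properties as AllP
import Data.List.Relation.Unary.Unique.Propositional.Properties as UniqueP
open import Data.List.Membership.Propositional using (_∈_)
open import Data.List.Membership.Propositional.Properties using (∈-tabulate⁺)
open import Data.Product using (Σ; ∃-syntax; _×_; _,_; proj₁; proj₂; swap)
open import Data.Sum as Sum using (_⊎_; inj₁; inj₂)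
open import Data.Empty using (⊥; ⊥-elim)
open import Function using (_∘_; id)
open import Function.Bundles using (_⇔_; mk⇔; Equivalence)
open import Function.Definitions using (Injective; Bijective)
open import Relation.Binary.PropositionalEquality as ≡
  using (_≡_; _≢_; refl; cong; cong₂; subst)
open import Relation.Nullary using (¬_; Dec; yes; no; does)
open import Relation.Nullary.Decidable using (dec-true; dec-false; _×-dec_)
open import Relation.Unary using (Decidable)

open Equivalence using (to; from)

i≤i+1 : ∀ i → i ≤ℤ i +ℤ 1ℤ
i≤i+1 i = ℤP.i≤i+j i 1ℤ

i<j⇒i+1≤j : ∀ {i j} → i <ℤ j → i +ℤ 1ℤ ≤ℤ j
i<j⇒i+1≤j {i} i<j = subst (_≤ℤ _) (ℤP.+-comm 1ℤ i) (ℤP.i<j⇒suc[i]≤j i<j)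

i+1≤j⇒i<j : ∀ {i j} → i +ℤ 1ℤ ≤ℤ j → i <ℤ j
i+1≤j⇒i<j {i} i+1≤j = ℤP.suc[i]≤j⇒i<j (subst (_≤ℤ _) (ℤP.+-comm i 1ℤ) i+1≤j)

i+1≤j⇒j≢i : ∀ {i j} → i +ℤ 1ℤ ≤ℤ j → j ≢ i
i+1≤j⇒j≢i i+1≤j refl = ℤP.<-irrefl refl (i+1≤j⇒i<j i+1≤j)

≰⇒+1≤ : ∀ {i j} → ¬ (i ≤ℤ j) → j +ℤ 1ℤ ≤ℤ i
≰⇒+1≤ = i<j⇒i+1≤j ∘ ℤP.≰⇒>

+1≤⇒≰ : ∀ {i j} → j +ℤ 1ℤ ≤ℤ i → ¬ (i ≤ℤ j)
+1≤⇒≰ = ℤP.<⇒≱ ∘ i+1≤j⇒i<j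

-- Linear inequalities are derived from a known one by matching differences with the ring solver.
≤-by-difference : ∀ {i j k l} → j -ℤ i ≡ l -ℤ k → k ≤ℤ l → i ≤ℤ j
≤-by-difference {i} {j} eq k≤l =
  ℤP.0≤i-j⇒j≤i (subst (0ℤ ≤ℤ_) (≡.sym eq) (ℤP.i≤j⇒0≤j-i k≤l))

i<i+1 : ∀ i → i <ℤ i +ℤ 1ℤ
i<i+1 i = i+1≤j⇒i<j ℤP.≤-refl

i<j+1⇒i≤j : ∀ {i j} → i <ℤ j +ℤ 1ℤ → i ≤ℤ j
i<j+1⇒i≤j {i} {j} i<j+1 = ≤-by-difference
  (solve 2 (λ i j → j :- i := (j :+ con 1ℤ) :- (i :+ con 1ℤ)) refl i j) (i<j⇒i+1≤j i<j+1)

i≤j⇒i<j+1 : ∀ {i j} → i ≤ℤ j → i <ℤ j +ℤ 1ℤ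
i≤j⇒i<j+1 {i} {j} i≤j = i+1≤j⇒i<j (ℤP.+-monoˡ-≤ 1ℤ i≤j)

≤⇒<⊎≡ : ∀ {i j} → i ≤ℤ j → (i <ℤ j) ⊎ (i ≡ j)
≤⇒<⊎≡ {i} {j} i≤j with i ℤ.≟ j
... | yes i≡j = inj₂ i≡j
... | no i≢j = inj₁ (ℤP.≤∧≢⇒< i≤j i≢j)

i≤j+1⇒i≤j⊎i≡j+1 : ∀ {i j} → i ≤ℤ j +ℤ 1ℤ → (i ≤ℤ j) ⊎ (i ≡ j +ℤ 1ℤ)
i≤j+1⇒i≤j⊎i≡j+1 {i} {j} i≤j+1 with ≤⇒<⊎≡ i≤j+1
... | inj₂ i≡j+1 = inj₂ i≡j+1
... | inj₁ i<j+1 = inj₁ (i<j+1⇒i≤j i<j+1)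

≤⇒+1≤⊎≡ : ∀ {i j} → i ≤ℤ j → (i +ℤ 1ℤ ≤ℤ j) ⊎ (i ≡ j)
≤⇒+1≤⊎≡ i≤j with ≤⇒<⊎≡ i≤j
... | inj₁ i<j = inj₁ (i<j⇒i+1≤j i<j)
... | inj₂ i≡j = inj₂ i≡j

+suc : ∀ k → + suc k ≡ + k +ℤ 1ℤ
+suc k = ≡.trans (cong +_ (ℕP.+-comm 1 k)) (ℤP.pos-+ k 1)

lo+[1+k]≡[lo+k]+1 : ∀ lo k → lo +ℤ + suc k ≡ (lo +ℤ + k) +ℤ 1ℤ
lo+[1+k]≡[lo+k]+1 lo k = ≡.trans (cong (lo +ℤ_) (+suc k)) (≡.sym (ℤP.+-assoc lo (+ k) 1ℤ))

+[1+m]-n≡[m-n]+1 : ∀ m n → + suc m -ℤ + n ≡ (+ m -ℤ + n) +ℤ 1ℤ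
+[1+m]-n≡[m-n]+1 m n = ≡.trans (cong (_-ℤ + n) (+suc m)) (solve 2 (λ a b → (a :+ con 1ℤ) :- b := (a :- b) :+ con 1ℤ) refl (+ m) (+ n))

m-n≡[m-[1+n]]+1 : ∀ m n → + m -ℤ + n ≡ (+ m -ℤ + suc n) +ℤ 1ℤ
m-n≡[m-[1+n]]+1 m n = ≡.trans (solve 2 (λ a b → a :- b := (a :- (b :+ con 1ℤ)) :+ con 1ℤ) refl (+ m) (+ n))
  (cong (λ b → (+ m -ℤ b) +ℤ 1ℤ) (≡.sym (+suc n)))

i≤+∣i∣ : ∀ i → i ≤ℤ + ℤ.∣ i ∣
i≤+∣i∣ (+ n) = ℤP.≤-refl
i≤+∣i∣ -[1+ n ] = ℤ.-≤+

module _ (g : ℤ → ℤ) (g-step : ∀ x → g (x +ℤ 1ℤ) ≡ g x +ℤ 1ℤ) where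

  step-by-one⇒+ℕ : ∀ x k → g (x +ℤ + k) ≡ g x +ℤ + k
  step-by-one⇒+ℕ x zero = ≡.trans (cong g (ℤP.+-identityʳ x)) (≡.sym (ℤP.+-identityʳ (g x)))
  step-by-one⇒+ℕ x (suc k) = begin
    g (x +ℤ + suc k)       ≡⟨ cong g (lo+[1+k]≡[lo+k]+1 x k) ⟩
    g ((x +ℤ + k) +ℤ 1ℤ)   ≡⟨ g-step (x +ℤ + k) ⟩
    g (x +ℤ + k) +ℤ 1ℤ     ≡⟨ cong (_+ℤ 1ℤ) (step-by-one⇒+ℕ x k) ⟩
    (g x +ℤ + k) +ℤ 1ℤ     ≡⟨ ≡.sym (lo+[1+k]≡[lo+k]+1 (g x) k) ⟩
    g x +ℤ + suc k         ∎
    where open ≡.≡-Reasoning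

  step-by-one⇒translation : ∀ x → g x ≡ x +ℤ g 0ℤ
  step-by-one⇒translation (+ k) = ≡.trans (step-by-one⇒+ℕ 0ℤ k) (ℤP.+-comm (g 0ℤ) (+ k))
  step-by-one⇒translation -[1+ k ] = begin
    g -[1+ k ]                           ≡⟨ solve 2 (λ y m → y := (y :+ m) :- m) refl (g -[1+ k ]) (+ suc k) ⟩
    (g -[1+ k ] +ℤ + suc k) -ℤ + suc k   ≡⟨ cong (_-ℤ + suc k) (≡.sym (step-by-one⇒+ℕ -[1+ k ] (suc k))) ⟩
    g (-[1+ k ] +ℤ + suc k) -ℤ + suc k   ≡⟨ cong (λ y → g y -ℤ + suc k) (ℤP.+-inverseˡ (+ suc k)) ⟩
    g 0ℤ -ℤ + suc k                      ≡⟨ solve 2 (λ z m → z :- m := (:- m) :+ z) refl (g 0ℤ) (+ suc k) ⟩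
    -[1+ k ] +ℤ g 0ℤ                     ∎
    where open ≡.≡-Reasoning

≡1⇒≢0 : ∀ {i} → i ≡ 1ℤ → i ≢ 0ℤ
≡1⇒≢0 refl ()

⊖-involutive : ∀ K d → K ⊖ (K ⊖ d) ≡ d
⊖-involutive (k₁ , k₂) (d₁ , d₂) = cong₂ _,_ (k-[k-i]≡i k₁ d₁) (k-[k-i]≡i k₂ d₂)
  where
  k-[k-i]≡i : ∀ k i → k -ℤ (k -ℤ i) ≡ i
  k-[k-i]≡i k i = solve 2 (λ k i → k :- (k :- i) := i) refl k i

≤P-reflect : ∀ K d a → ((d ⊕ 𝟏) ≤P a) ⇔ (((K ⊕ 𝟏) ⊖ a) ≤P (K ⊖ d))
≤P-reflect (k₁ , k₂) (d₁ , d₂) (a₁ , a₂) =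
  mk⇔ (λ (l₁ , l₂) → forth k₁ d₁ a₁ l₁ , forth k₂ d₂ a₂ l₂) (λ (l₁ , l₂) → back k₁ d₁ a₁ l₁ , back k₂ d₂ a₂ l₂)
  where
  forth : ∀ k i a → i +ℤ 1ℤ ≤ℤ a → (k +ℤ 1ℤ) -ℤ a ≤ℤ k -ℤ i
  forth k i a = ≤-by-difference (solve 3 (λ k i a → (k :- i) :- ((k :+ con 1ℤ) :- a) := a :- (i :+ con 1ℤ)) refl k i a)
  back : ∀ k i a → (k +ℤ 1ℤ) -ℤ a ≤ℤ k -ℤ i → i +ℤ 1ℤ ≤ℤ a
  back k i a = ≤-by-difference (solve 3 (λ k i a → a :- (i :+ con 1ℤ) := (k :- i) :- ((k :+ con 1ℤ) :- a)) refl k i a)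

Enumerable : {A : Set} → (A → Set) → Set
Enumerable P = ∃[ n ] ∃[ e ] Enumerates P n e

module _ {A : Set} where

  enumerates-∅ : {P : A → Set} → (∀ a → ¬ P a) → Enumerates P 0 (λ ())
  enumerates-∅ ¬P = (λ ()) , (λ {}) , λ a Pa → ⊥-elim (¬P a Pa)

  enumerates-∅⇒0 : {P : A → Set} {n : ℕ} {e : Fin n → A} →
    (∀ a → ¬ P a) → Enumerates P n e → n ≡ 0
  enumerates-∅⇒0 {n = zero} ¬P _ = refl
  enumerates-∅⇒0 {n = suc n} ¬P (valid , _) = ⊥-elim (¬P _ (valid zero))

  enumerates-⇔ : {P Q : A → Set} {n : ℕ} {e : Fin n → A} →
    (∀ a → P a ⇔ Q a) → Enumerates P n e → Enumerates Q n e
  enumerates-⇔ P⇔Q (valid , inj , surj) =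
    (λ i → to (P⇔Q _) (valid i)) , inj , λ a Qa → surj a (from (P⇔Q a) Qa)

  enumerates-insert : {P Q : A → Set} {n : ℕ} {e : Fin n → A} (x : A) → ¬ P x →
    (∀ a → Q a ⇔ (P a ⊎ a ≡ x)) → Enumerates P n e → Enumerates Q (suc n) (x ◂ e)
  enumerates-insert {P = P} {Q} {e = e} x ¬Px Q⇔ (valid , inj , surj) = valid′ , inj′ , surj′
    where
    valid′ : ∀ i → Q ((x ◂ e) i)
    valid′ zero = from (Q⇔ x) (inj₂ refl)
    valid′ (suc i) = from (Q⇔ (e i)) (inj₁ (valid i))
    inj′ : Injective _≡_ _≡_ (x ◂ e)
    inj′ {zero} {zero} _ = refl
    inj′ {zero} {suc j} x≡ej = ⊥-elim (¬Px (subst P (≡.sym x≡ej) (valid j)))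
    inj′ {suc i} {zero} ei≡x = ⊥-elim (¬Px (subst P ei≡x (valid i)))
    inj′ {suc i} {suc j} ei≡ej = cong suc (inj ei≡ej)
    surj′ : ∀ a → Q a → ∃[ i ] ((x ◂ e) i ≡ a)
    surj′ a Qa with to (Q⇔ a) Qa
    ... | inj₂ refl = zero , refl
    ... | inj₁ Pa = let i , ei≡a = surj a Pa in suc i , ei≡a

  enumerates-image : {B : Set} {P : A → Set} {Q : B → Set} {n : ℕ} {e : Fin n → A} (g : A → B) →
    Injective _≡_ _≡_ g → (∀ b → Q b ⇔ (∃[ a ] (P a × g a ≡ b))) →
    Enumerates P n e → Enumerates Q n (g ∘ e)
  enumerates-image {Q = Q} {e = e} g g-inj Q⇔ (valid , inj , surj) =
    (λ i → from (Q⇔ _) (_ , valid i , refl)) , inj ∘ g-inj , surj′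
    where
    surj′ : ∀ b → Q b → ∃[ i ] (g (e i) ≡ b)
    surj′ b Qb with to (Q⇔ b) Qb
    ... | a , Pa , refl = let i , ei≡a = surj a Pa in i , cong g ei≡a

  enumerates-size-unique : {P : A → Set} {n m : ℕ} {e : Fin n → A} {e′ : Fin m → A} →
    Enumerates P n e → Enumerates P m e′ → n ≡ m
  enumerates-size-unique {P} en en′ =
    ℕP.≤-antisym (FinP.injective⇒≤ (reindex-injective en en′)) (FinP.injective⇒≤ (reindex-injective en′ en))
    where
    reindex-injective : ∀ {n m} {e : Fin n → A} {e′ : Fin m → A} (en : Enumerates P n e) (en′ : Enumerates P m e′) →
      Injective _≡_ _≡_ (λ i → proj₁ (proj₂ (proj₂ en′) (e i) (proj₁ en i)))
    reindex-injective {e = e} {e′} (valid , inj , _) (valid′ , _ , surj′) {i} {j} eq =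
      inj (≡.trans (≡.sym (proj₂ (surj′ (e i) (valid i)))) (≡.trans (cong e′ eq) (proj₂ (surj′ (e j) (valid j)))))

  module _ {P P′ : A → Set} {R : Set} {x : A} (P′⇔ : ∀ a → P′ a ⇔ (P a ⊎ (a ≡ x × R))) where

    inserted-when : R → ∀ a → P′ a ⇔ (P a ⊎ a ≡ x)
    inserted-when r a = mk⇔ (Sum.map₂ proj₁ ∘ to (P′⇔ a)) (from (P′⇔ a) ∘ Sum.map₂ (_, r))

    unchanged-unless : ¬ R → ∀ a → P a ⇔ P′ a
    unchanged-unless ¬r a = mk⇔ (from (P′⇔ a) ∘ inj₁) (Sum.[ id , (λ (_ , r) → ⊥-elim (¬r r)) ] ∘ to (P′⇔ a))

    enumerable-insertion : Dec R → ¬ P x → Enumerable P → Enumerable P′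
    enumerable-insertion (yes r) ¬Px (n , e , en) = suc n , x ◂ e , enumerates-insert x ¬Px (inserted-when r) en
    enumerable-insertion (no ¬r) _ (n , e , en) = n , e , enumerates-⇔ (unchanged-unless ¬r) en

    insertion-size : ∀ {n n′} {e : Fin n → A} {e′ : Fin n′ → A} → ¬ P x →
      Enumerates P n e → Enumerates P′ n′ e′ → (R → n′ ≡ suc n) × (¬ R → n′ ≡ n)
    insertion-size ¬Px en en′ =
      (λ r → enumerates-size-unique en′ (enumerates-insert x ¬Px (inserted-when r) en)) ,
      (λ ¬r → enumerates-size-unique en′ (enumerates-⇔ (unchanged-unless ¬r) en))

enumerable-interval : {Q : ℤ → Set} → Decidable Q → ∀ lo k → Enumerable (λ i → Q i × lo ≤ℤ i × i <ℤ lo +ℤ + k)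
enumerable-interval Q? lo zero =
  0 , (λ ()) , enumerates-∅ (λ i (_ , lo≤i , i<lo+0) → ℤP.<-irrefl refl (ℤP.≤-<-trans lo≤i (subst (i <ℤ_) (ℤP.+-identityʳ lo) i<lo+0)))
enumerable-interval {Q} Q? lo (suc k) =
  enumerable-insertion split (Q? (lo +ℤ + k)) (λ (_ , _ , x<x) → ℤP.<-irrefl refl x<x) (enumerable-interval Q? lo k)
  where
  x : ℤ
  x = lo +ℤ + k
  x+1≡ : lo +ℤ + suc k ≡ x +ℤ 1ℤ
  x+1≡ = lo+[1+k]≡[lo+k]+1 lo k
  split : ∀ a → (Q a × lo ≤ℤ a × a <ℤ lo +ℤ + suc k) ⇔ ((Q a × lo ≤ℤ a × a <ℤ x) ⊎ (a ≡ x × Q x))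
  split a = mk⇔ forth back
    where
    forth : (Q a × lo ≤ℤ a × a <ℤ lo +ℤ + suc k) → (Q a × lo ≤ℤ a × a <ℤ x) ⊎ (a ≡ x × Q x)
    forth (Qa , lo≤a , a<) with ≤⇒<⊎≡ {j = x} (i<j+1⇒i≤j (subst (a <ℤ_) x+1≡ a<))
    ... | inj₁ a<x = inj₁ (Qa , lo≤a , a<x)
    ... | inj₂ refl = inj₂ (refl , Qa)
    back : (Q a × lo ≤ℤ a × a <ℤ x) ⊎ (a ≡ x × Q x) → Q a × lo ≤ℤ a × a <ℤ lo +ℤ + suc k
    back (inj₁ (Qa , lo≤a , a<x)) = Qa , lo≤a , subst (a <ℤ_) (≡.sym x+1≡) (ℤP.<-trans a<x (i<i+1 x))
    back (inj₂ (refl , Qx)) = Qx , ℤP.i≤i+j lo (+ k) , subst (a <ℤ_) (≡.sym x+1≡) (i<i+1 x)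

enumerable-bounded : {Q : ℤ → Set} → Decidable Q → ∀ lo hi → (∀ i → Q i → lo ≤ℤ i × i ≤ℤ hi) → Enumerable Q
enumerable-bounded {Q} Q? lo hi bounds =
  let n , e , en = enumerable-interval Q? lo (suc ℤ.∣ hi -ℤ lo ∣) in n , e , enumerates-⇔ drop-bounds en
  where
  hi≤ : hi ≤ℤ lo +ℤ + ℤ.∣ hi -ℤ lo ∣
  hi≤ = ≤-by-difference (solve 3 (λ hi lo m → (lo :+ m) :- hi := m :- (hi :- lo)) refl hi lo (+ ℤ.∣ hi -ℤ lo ∣))
          (i≤+∣i∣ (hi -ℤ lo))
  drop-bounds : ∀ i → (Q i × lo ≤ℤ i × i <ℤ lo +ℤ + suc ℤ.∣ hi -ℤ lo ∣) ⇔ Q i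
  drop-bounds i = mk⇔ proj₁ λ Qi → Qi , proj₁ (bounds i Qi) ,
    subst (i <ℤ_) (≡.sym (lo+[1+k]≡[lo+k]+1 lo _))
      (i≤j⇒i<j+1 (ℤP.≤-trans (proj₂ (bounds i Qi)) hi≤))

module _ {A : Set} {P P′ Q Q′ : A → Set} {R : Set} {x : A}
         (P′⇔ : ∀ a → P′ a ⇔ (P a ⊎ (a ≡ x × R))) (Q⇔ : ∀ a → Q a ⇔ (Q′ a ⊎ (a ≡ x × ¬ R))) where

  count-difference-step : Dec R → ¬ P x → ¬ Q′ x →
    ∀ {n₀ n₁ n₀′ n₁′} {e₀ : Fin n₀ → A} {e₁ : Fin n₁ → A} {e₀′ : Fin n₀′ → A} {e₁′ : Fin n₁′ → A} →
    Enumerates P n₀ e₀ → Enumerates Q n₁ e₁ → Enumerates P′ n₀′ e₀′ → Enumerates Q′ n₁′ e₁′ →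
    + n₀′ -ℤ + n₁′ ≡ (+ n₀ -ℤ + n₁) +ℤ 1ℤ
  count-difference-step R? ¬Px ¬Q′x {n₀} {n₁} {n₀′} {n₁′} en₀ en₁ en₀′ en₁′ = by-cases R?
    where
    open ≡.≡-Reasoning
    P-grows : (R → n₀′ ≡ suc n₀) × (¬ R → n₀′ ≡ n₀)
    P-grows = insertion-size P′⇔ ¬Px en₀ en₀′
    Q-shrinks : (¬ R → n₁ ≡ suc n₁′) × (¬ ¬ R → n₁ ≡ n₁′)
    Q-shrinks = insertion-size Q⇔ ¬Q′x en₁′ en₁
    by-cases : Dec R → + n₀′ -ℤ + n₁′ ≡ (+ n₀ -ℤ + n₁) +ℤ 1ℤ
    by-cases (yes r) = begin
      + n₀′ -ℤ + n₁′             ≡⟨ cong₂ (λ a b → + a -ℤ + b) (proj₁ P-grows r) (≡.sym (proj₂ Q-shrinks (λ ¬r → ¬r r))) ⟩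
      + suc n₀ -ℤ + n₁           ≡⟨ +[1+m]-n≡[m-n]+1 n₀ n₁ ⟩
      (+ n₀ -ℤ + n₁) +ℤ 1ℤ       ∎
    by-cases (no ¬r) = begin
      + n₀′ -ℤ + n₁′             ≡⟨ cong (λ a → + a -ℤ + n₁′) (proj₂ P-grows ¬r) ⟩
      + n₀ -ℤ + n₁′              ≡⟨ m-n≡[m-[1+n]]+1 n₀ n₁′ ⟩
      (+ n₀ -ℤ + suc n₁′) +ℤ 1ℤ  ≡⟨ cong (λ b → (+ n₀ -ℤ + b) +ℤ 1ℤ) (≡.sym (proj₁ Q-shrinks ¬r)) ⟩
      (+ n₀ -ℤ + n₁) +ℤ 1ℤ       ∎

Box : (ℤ → ℤ) → (ℤ → ℤ) → ℤ → ℤ → ℤ → Set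
Box f g d e a = (f a ≤ℤ d) × (g a ≤ℤ e)

Cobox : (ℤ → ℤ) → (ℤ → ℤ) → ℤ → ℤ → ℤ → Set
Cobox f g d e a = (d +ℤ 1ℤ ≤ℤ f a) × (e +ℤ 1ℤ ≤ℤ g a)

box? : ∀ f g d e → Decidable (Box f g d e)
box? f g d e a = (f a ℤP.≤? d) ×-dec (g a ℤP.≤? e)

cobox? : ∀ f g d e → Decidable (Cobox f g d e)
cobox? f g d e a = ((d +ℤ 1ℤ) ℤP.≤? f a) ×-dec ((e +ℤ 1ℤ) ℤP.≤? g a)

-- Raising d by one moves the unique x with f x = d + 1 either into the box or out of the cobox.
box-count-step : ∀ f g d e x → (∀ a → f a ≡ d +ℤ 1ℤ → a ≡ x) → f x ≡ d +ℤ 1ℤ →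
  ∀ {n₀ n₁ n₀′ n₁′} {e₀ : Fin n₀ → ℤ} {e₁ : Fin n₁ → ℤ} {e₀′ : Fin n₀′ → ℤ} {e₁′ : Fin n₁′ → ℤ} →
  Enumerates (Box f g d e) n₀ e₀ → Enumerates (Cobox f g d e) n₁ e₁ →
  Enumerates (Box f g (d +ℤ 1ℤ) e) n₀′ e₀′ → Enumerates (Cobox f g (d +ℤ 1ℤ) e) n₁′ e₁′ →
  + n₀′ -ℤ + n₁′ ≡ (+ n₀ -ℤ + n₁) +ℤ 1ℤ
box-count-step f g d e x fibre fx≡d+1 =
  count-difference-step grow shrink (g x ℤP.≤? e)
    (λ (fx≤d , _) → ℤP.<-irrefl fx≡d+1 (ℤP.≤-<-trans fx≤d (i<i+1 d)))
    (λ (d+2≤fx , _) → i+1≤j⇒j≢i d+2≤fx fx≡d+1)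
  where
  grow : ∀ a → Box f g (d +ℤ 1ℤ) e a ⇔ (Box f g d e a ⊎ (a ≡ x × g x ≤ℤ e))
  grow a = mk⇔ forth back
    where
    forth : Box f g (d +ℤ 1ℤ) e a → Box f g d e a ⊎ (a ≡ x × g x ≤ℤ e)
    forth (fa≤d+1 , ga≤e) with i≤j+1⇒i≤j⊎i≡j+1 fa≤d+1
    ... | inj₁ fa≤d = inj₁ (fa≤d , ga≤e)
    ... | inj₂ fa≡d+1 with fibre a fa≡d+1
    ... | refl = inj₂ (refl , ga≤e)
    back : Box f g d e a ⊎ (a ≡ x × g x ≤ℤ e) → Box f g (d +ℤ 1ℤ) e a
    back (inj₁ (fa≤d , ga≤e)) = ℤP.≤-trans fa≤d (i≤i+1 d) , ga≤e
    back (inj₂ (refl , gx≤e)) = ℤP.≤-reflexive fx≡d+1 , gx≤e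
  shrink : ∀ a → Cobox f g d e a ⇔ (Cobox f g (d +ℤ 1ℤ) e a ⊎ (a ≡ x × ¬ g x ≤ℤ e))
  shrink a = mk⇔ forth back
    where
    forth : Cobox f g d e a → Cobox f g (d +ℤ 1ℤ) e a ⊎ (a ≡ x × ¬ g x ≤ℤ e)
    forth (d+1≤fa , e+1≤ga) with ≤⇒+1≤⊎≡ d+1≤fa
    ... | inj₁ d+2≤fa = inj₁ (d+2≤fa , e+1≤ga)
    ... | inj₂ d+1≡fa with fibre a (≡.sym d+1≡fa)
    ... | refl = inj₂ (refl , +1≤⇒≰ e+1≤ga)
    back : Cobox f g (d +ℤ 1ℤ) e a ⊎ (a ≡ x × ¬ g x ≤ℤ e) → Cobox f g d e a
    back (inj₁ (d+2≤fa , e+1≤ga)) = ℤP.≤-trans (i≤i+1 _) d+2≤fa , e+1≤ga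
    back (inj₂ (refl , gx≰e)) = ℤP.≤-reflexive (≡.sym fx≡d+1) , ≰⇒+1≤ gx≰e

sum-tabulate-ones : ∀ {A : Set} {n} (f : Fin n → A) (g : A → ℤ) → (∀ i → g (f i) ≡ 1ℤ) →
  foldr _+ℤ_ 0ℤ (map g (tabulate f)) ≡ + n
sum-tabulate-ones {n = zero} f g g∘f≡1 = refl
sum-tabulate-ones {n = suc n} f g g∘f≡1 =
  ≡.trans (cong₂ _+ℤ_ (g∘f≡1 zero) (sum-tabulate-ones (f ∘ suc) g (g∘f≡1 ∘ suc)))
    (≡.trans (ℤP.+-comm 1ℤ (+ n)) (≡.sym (+suc n)))

sumBelow-enumeration : ∀ (W : Pt → ℤ) d {n} {e : Fin n → Pt} → (∀ p → W p ≢ 0ℤ → W p ≡ 1ℤ) →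
  Enumerates (λ p → (W p ≡ 1ℤ) × (p ≤P d)) n e → SumBelow W d (+ n)
sumBelow-enumeration W d {e = e} W≢0⇒W≡1 (valid , inj , surj) =
  tabulate e , UniqueP.tabulate⁺ inj , AllP.tabulate⁺ (proj₂ ∘ valid) , complete ,
  sum-tabulate-ones e W (proj₁ ∘ valid)
  where
  complete : ∀ p → p ≤P d → W p ≢ 0ℤ → p ∈ tabulate e
  complete p p≤d Wp≢0 = let i , ei≡p = surj p (W≢0⇒W≡1 p Wp≢0 , p≤d) in subst (_∈ tabulate e) ei≡p (∈-tabulate⁺ i)

enumerates-dual : ∀ (W : Pt → ℤ) K d {n} {e : Fin n → Pt} →
  Enumerates (λ a → (W a ≡ 1ℤ) × ((d ⊕ 𝟏) ≤P a)) n e →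
  Enumerates (λ p → (dual (K ⊕ 𝟏) W p ≡ 1ℤ) × (p ≤P (K ⊖ d))) n (((K ⊕ 𝟏) ⊖_) ∘ e)
enumerates-dual W K d = enumerates-image (L ⊖_) reflect-injective image
  where
  L : Pt
  L = K ⊕ 𝟏
  reflect-injective : Injective _≡_ _≡_ (L ⊖_)
  reflect-injective {a} {b} La≡Lb = ≡.trans (≡.sym (⊖-involutive L a)) (≡.trans (cong (L ⊖_) La≡Lb) (⊖-involutive L b))
  image : ∀ p → ((W (L ⊖ p) ≡ 1ℤ) × (p ≤P (K ⊖ d))) ⇔ (∃[ a ] (((W a ≡ 1ℤ) × ((d ⊕ 𝟏) ≤P a)) × L ⊖ a ≡ p))
  image p = mk⇔
    (λ (w , p≤) → L ⊖ p , (w , from (≤P-reflect K d (L ⊖ p)) (subst (_≤P (K ⊖ d)) (≡.sym (⊖-involutive L p)) p≤)) , ⊖-involutive L p)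
    (λ { (a , (w , d+1≤a) , refl) → subst (λ b → W b ≡ 1ℤ) (≡.sym (⊖-involutive L a)) w , to (≤P-reflect K d a) d+1≤a })

module FieldLinearAlgebra {c ℓ} (F : Field c ℓ) where
  open Field F hiding (zero) renaming (refl to ≈-refl; sym to ≈-sym; trans to ≈-trans; reflexive to ≈-reflexive)
  open import Algebra.Properties.Semiring.Sum semiring public
    using (sum; sum-remove; ∑-distrib-+; ∑-comm; sum-cong-≋; sum-replicate-zero; *-distribˡ-sum; *-distribʳ-sum)
  open import Algebra.Properties.Ring ring public
    using (-‿distribˡ-*; -‿distribʳ-*; -1*x≈-x; -0#≈0#; -‿+-comm; x∙y⁻¹≈ε⇒x≈y; -‿involutive)
  open import Algebra.Properties.CommutativeSemigroup +-commutativeSemigroup public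
    using () renaming (interchange to +-interchange)
  open import Relation.Binary.Reasoning.Setoid setoid

  sum-cong : ∀ {n} {f g : Fin n → Carrier} → (∀ j → f j ≈ g j) → sum f ≈ sum g
  sum-cong = sum-cong-≋

  sum-zeros : ∀ {n} (f : Fin n → Carrier) → (∀ j → f j ≈ 0#) → sum f ≈ 0#
  sum-zeros {n} f f≈0 = ≈-trans (sum-cong f≈0) (sum-replicate-zero n)

  sum-δ : ∀ {n} (f : Fin n → Carrier) (i : Fin n) → (∀ j → j ≢ i → f j ≈ 0#) → sum f ≈ f i
  sum-δ {suc n} f i f≈0 = ≈-trans (sum-remove {i = i} f)
    (≈-trans (+-congˡ (sum-zeros _ (λ j → f≈0 (punchIn i j) (FinP.punchInᵢ≢i i j)))) (+-identityʳ _))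

  neg-sum : ∀ {n} (f : Fin n → Carrier) → - sum f ≈ sum (λ j → - f j)
  neg-sum f = ≈-trans (≈-sym (-1*x≈-x _)) (≈-trans (*-distribˡ-sum (- 1#) f) (sum-cong (λ j → -1*x≈-x (f j))))

  0-[-x*y]≈x*y : ∀ x y → 0# - (- x * y) ≈ x * y
  0-[-x*y]≈x*y x y = ≈-trans (+-identityˡ _) (≈-trans (-‿cong (≈-sym (-‿distribˡ-* x y))) (-‿involutive _))

  infix 7 _·_
  _·_ : ∀ {n} → (Fin n → Carrier) → (Fin n → Carrier) → Carrier
  u · v = sum (λ j → u j * v j)

  ·-comm : ∀ {n} (a b : Fin n → Carrier) → a · b ≈ b · a
  ·-comm a b = sum-cong (λ j → *-comm (a j) (b j))

  ·-difference : ∀ {n} (a f g : Fin n → Carrier) → a · f - a · g ≈ a · (λ j → f j - g j)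
  ·-difference a f g = begin
    a · f - a · g                           ≈⟨ +-congˡ (neg-sum (λ j → a j * g j)) ⟩
    a · f + sum (λ j → - (a j * g j))       ≈⟨ ≈-sym (∑-distrib-+ (λ j → a j * f j) (λ j → - (a j * g j))) ⟩
    sum (λ j → a j * f j + - (a j * g j))
      ≈⟨ sum-cong (λ j → ≈-trans (+-congˡ (-‿distribʳ-* (a j) (g j))) (≈-sym (distribˡ (a j) (f j) (- g j)))) ⟩
    a · (λ j → f j - g j)                   ∎

  single : ∀ {n} → Fin n → Carrier → Fin n → Carrier
  single i a j = if does (j Fin.≟ i) then a else 0#

  single-· : ∀ {n} (i : Fin n) a f → single i a · f ≈ a * f i
  single-· i a f = ≈-trans (sum-δ _ i (λ j j≢i → ≈-trans (*-congʳ (≈-reflexive (cong (if_then a else 0#) (dec-false (j Fin.≟ i) j≢i)))) (zeroˡ _)))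
    (*-congʳ (≈-reflexive (cong (if_then a else 0#) (dec-true (i Fin.≟ i) refl))))

  Matrix : ℕ → ℕ → Set c
  Matrix m n = Fin m → Fin n → Carrier

  KernelFree : ∀ {m n} → Matrix m n → Set (c ⊔ ℓ)
  KernelFree A = ∀ x → (∀ i → A i · x ≈ 0#) → ∀ j → x j ≈ 0#

  -- Equality in a field need not be decidable, so a pivot can only be found under double negation.
  KernelFree¬¬ : ∀ {m n} → Matrix m n → Set (c ⊔ ℓ)
  KernelFree¬¬ A = ∀ x → (∀ i → A i · x ≈ 0#) → ∀ j → ¬ ¬ (x j ≈ 0#)

  ¬¬-∀-Fin : ∀ {p} n (P : Fin n → Set p) → (∀ j → ¬ ¬ P j) → ¬ ¬ (∀ j → P j)
  ¬¬-∀-Fin zero P ¬¬P k = k (λ ())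
  ¬¬-∀-Fin (suc n) P ¬¬P k =
    ¬¬P zero λ P₀ → ¬¬-∀-Fin n (P ∘ suc) (¬¬P ∘ suc) λ Pₛ → k λ { zero → P₀ ; (suc j) → Pₛ j }

  kernelFree¬¬-dropZeroRow : ∀ {m n} (A : Matrix (suc m) n) →
    (∀ j → ¬ ¬ (A zero j ≈ 0#)) → KernelFree¬¬ A → KernelFree¬¬ (A ∘ suc)
  kernelFree¬¬-dropZeroRow {n = n} A A₀≈0 kf x Ax≈0 j x≉0 =
    ¬¬-∀-Fin n _ A₀≈0 λ A₀≈0 → kf x (rows A₀≈0) j x≉0
    where
    rows : (∀ j → A zero j ≈ 0#) → ∀ i → A i · x ≈ 0#
    rows A₀≈0 zero = sum-zeros _ (λ j → ≈-trans (*-congʳ (A₀≈0 j)) (zeroˡ _))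
    rows A₀≈0 (suc i) = Ax≈0 i

  eliminate : ∀ {m n} → Matrix (suc m) (suc n) → Fin (suc n) → Carrier → Matrix m n
  eliminate A j₀ p i j = A (suc i) (punchIn j₀ j) - A (suc i) j₀ * (p * A zero (punchIn j₀ j))

  eliminate-· : ∀ {m n} (A : Matrix (suc m) (suc n)) j₀ p i y →
    eliminate A j₀ p i · y ≈ (λ j → A (suc i) (punchIn j₀ j)) · y - A (suc i) j₀ * (p * ((λ j → A zero (punchIn j₀ j)) · y))
  eliminate-· {n = n} A j₀ p i y = begin
    sum (λ j → (Aᵢ j - a * (p * A₀ j)) * y j)
      ≈⟨ sum-cong (λ j → ≈-trans (distribʳ (y j) _ _) (+-congˡ (≈-sym (-‿distribˡ-* _ _)))) ⟩
    sum (λ j → Aᵢ j * y j + - ((a * (p * A₀ j)) * y j))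
      ≈⟨ ∑-distrib-+ (λ j → Aᵢ j * y j) (λ j → - ((a * (p * A₀ j)) * y j)) ⟩
    Aᵢ · y + sum (λ j → - ((a * (p * A₀ j)) * y j))
      ≈⟨ +-congˡ (≈-sym (neg-sum (λ j → (a * (p * A₀ j)) * y j))) ⟩
    Aᵢ · y - sum (λ j → (a * (p * A₀ j)) * y j)
      ≈⟨ +-congˡ (-‿cong (sum-cong (λ j → ≈-trans (*-assoc a (p * A₀ j) (y j)) (*-congˡ (*-assoc p (A₀ j) (y j)))))) ⟩
    Aᵢ · y - sum (λ j → a * (p * (A₀ j * y j)))
      ≈⟨ +-congˡ (-‿cong (≈-sym (*-distribˡ-sum a (λ j → p * (A₀ j * y j))))) ⟩
    Aᵢ · y - a * sum (λ j → p * (A₀ j * y j))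
      ≈⟨ +-congˡ (-‿cong (*-congˡ (≈-sym (*-distribˡ-sum p (λ j → A₀ j * y j))))) ⟩
    Aᵢ · y - a * (p * (A₀ · y))               ∎
    where
    A₀ Aᵢ : Fin n → Carrier
    A₀ j = A zero (punchIn j₀ j)
    Aᵢ j = A (suc i) (punchIn j₀ j)
    a : Carrier
    a = A (suc i) j₀

  -- A kernel vector of the eliminated matrix extends, by solving row 0 for the pivot
  -- coordinate, to a kernel vector of A.
  kernelFree¬¬-eliminate : ∀ {m n} (A : Matrix (suc m) (suc n)) j₀ p → A zero j₀ * p ≈ 1# →
    KernelFree¬¬ A → KernelFree¬¬ (eliminate A j₀ p)
  kernelFree¬¬-eliminate {n = n} A j₀ p pivot kf y Ey≈0 j y≉0 =
    kf x rows (punchIn j₀ j) (y≉0 ∘ ≈-trans (≈-reflexive (≡.sym (insertAt-punchIn y j₀ _ j))))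
    where
    A₀ : Fin n → Carrier
    A₀ j = A zero (punchIn j₀ j)
    S : Carrier
    S = A₀ · y
    x : Fin (suc n) → Carrier
    x = insertAt y j₀ (- (p * S))
    split : ∀ r → r · x ≈ r j₀ * - (p * S) + (λ j → r (punchIn j₀ j)) · y
    split r = ≈-trans (sum-remove {i = j₀} (λ j → r j * x j))
      (+-cong (*-congˡ (≈-reflexive (insertAt-lookup y j₀ _)))
              (sum-cong (λ j → *-congˡ (≈-reflexive (insertAt-punchIn y j₀ _ j)))))
    rows : ∀ i → A i · x ≈ 0#
    rows zero = begin
      A zero · x                              ≈⟨ split (A zero) ⟩
      A zero j₀ * - (p * S) + S               ≈⟨ +-congʳ (≈-sym (-‿distribʳ-* _ _)) ⟩
      - (A zero j₀ * (p * S)) + S             ≈⟨ +-congʳ (-‿cong (≈-sym (*-assoc _ _ _))) ⟩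
      - ((A zero j₀ * p) * S) + S             ≈⟨ +-congʳ (-‿cong (≈-trans (*-congʳ pivot) (*-identityˡ S))) ⟩
      - S + S                                 ≈⟨ -‿inverseˡ S ⟩
      0#                                      ∎
    rows (suc i) = begin
      A (suc i) · x                           ≈⟨ split (A (suc i)) ⟩
      a * - (p * S) + T                       ≈⟨ +-comm _ _ ⟩
      T + a * - (p * S)                       ≈⟨ +-congˡ (≈-sym (-‿distribʳ-* _ _)) ⟩
      T - a * (p * S)                         ≈⟨ ≈-sym (eliminate-· A j₀ p i y) ⟩
      eliminate A j₀ p i · y                  ≈⟨ Ey≈0 i ⟩
      0#                                      ∎
      where
      a T : Carrier
      a = A (suc i) j₀
      T = (λ j → A (suc i) (punchIn j₀ j)) · y

  wide⇒¬kernelFree¬¬ : ∀ {m n} → m ℕ.< n → (A : Matrix m n) → ¬ KernelFree¬¬ A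
  wide⇒¬kernelFree¬¬ {zero} {suc n} _ A kf = kf (λ _ → 1#) (λ ()) zero nontrivial
  wide⇒¬kernelFree¬¬ {suc m} {suc n} (s≤s m<n) A kf = no-pivot⇒⊥ pivot⇒⊥
    where
    pivot⇒⊥ : ∃[ j₀ ] ¬ (A zero j₀ ≈ 0#) → ⊥
    pivot⇒⊥ (j₀ , A₀j₀≉0) = let p , pivot = inverse _ A₀j₀≉0 in
      wide⇒¬kernelFree¬¬ m<n (eliminate A j₀ p) (kernelFree¬¬-eliminate A j₀ p pivot kf)
    no-pivot⇒⊥ : ¬ (∃[ j₀ ] ¬ (A zero j₀ ≈ 0#)) → ⊥
    no-pivot⇒⊥ no-pivot = wide⇒¬kernelFree¬¬ (ℕP.m<n⇒m<1+n m<n) (A ∘ suc)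
      (kernelFree¬¬-dropZeroRow A (λ j A₀j≉0 → no-pivot (j , A₀j≉0)) kf)

  kernelFree⇒≤ : ∀ {m n} (A : Matrix m n) → KernelFree A → n ℕ.≤ m
  kernelFree⇒≤ A kf = ℕP.≮⇒≥ λ m<n → wide⇒¬kernelFree¬¬ m<n A (λ x Ax≈0 j ¬x≈0 → ¬x≈0 (kf x Ax≈0 j))

  Biorthogonal : ∀ {m n} → Matrix m n → Matrix m n → Set ℓ
  Biorthogonal B A = (∀ i → B i · A i ≈ 1#) × (∀ i l → i ≢ l → B i · A l ≈ 0#)

  transpose : ∀ {m n} → Matrix m n → Matrix n m
  transpose A j i = A i j

  biorthogonal⇒transpose-kernelFree : ∀ {m n} (B A : Matrix m n) → Biorthogonal B A → KernelFree (transpose B)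
  biorthogonal⇒transpose-kernelFree B A (BA≈1 , BA≈0) x Bᵀx≈0 l = begin
    x l                                         ≈⟨ ≈-sym (≈-trans (*-congˡ (BA≈1 l)) (*-identityʳ _)) ⟩
    x l * (B l · A l)                           ≈⟨ ≈-sym (sum-δ (λ i → x i * (B i · A l)) l
                                                     (λ i i≢l → ≈-trans (*-congˡ (BA≈0 i l i≢l)) (zeroʳ _))) ⟩
    sum (λ i → x i * (B i · A l))               ≈⟨ sum-cong (λ i → *-distribˡ-sum (x i) (λ j → B i j * A l j)) ⟩
    sum (λ i → sum (λ j → x i * (B i j * A l j))) ≈⟨ ∑-comm (λ i j → x i * (B i j * A l j)) ⟩
    sum (λ j → sum (λ i → x i * (B i j * A l j))) ≈⟨ sum-cong (λ j → sum-cong (λ i →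
                                                     ≈-trans (≈-sym (*-assoc (x i) (B i j) (A l j))) (*-congʳ (*-comm (x i) (B i j))))) ⟩
    sum (λ j → sum (λ i → (B i j * x i) * A l j)) ≈⟨ sum-cong (λ j → ≈-sym (*-distribʳ-sum (A l j) (λ i → B i j * x i))) ⟩
    sum (λ j → (transpose B j · x) * A l j)     ≈⟨ sum-zeros _ (λ j → ≈-trans (*-congʳ (Bᵀx≈0 j)) (zeroˡ _)) ⟩
    0#                                          ∎

  kernelFree∧biorthogonal⇒≡ : ∀ {m n} (A B : Matrix m n) → KernelFree A → Biorthogonal B A → n ≡ m
  kernelFree∧biorthogonal⇒≡ A B kf bi =
    ℕP.≤-antisym (kernelFree⇒≤ A kf) (kernelFree⇒≤ (transpose B) (biorthogonal⇒transpose-kernelFree B A bi))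

module Coordinates {c ℓ} (F : Field c ℓ) where
  open Field F hiding (zero) renaming (refl to ≈-refl; sym to ≈-sym; trans to ≈-trans; reflexive to ≈-reflexive)
  open FieldLinearAlgebra F
  open LinAlg F
  open import Relation.Binary.Reasoning.Setoid setoid

  module _ (S : Based) where

    coeff-++ : ∀ x y t → coeff S (x ++ y) t ≈ coeff S x t + coeff S y t
    coeff-++ [] y t = ≈-sym (+-identityˡ _)
    coeff-++ ((s , a) ∷ x) y t = ≈-trans (+-congˡ (coeff-++ x y t)) (≈-sym (+-assoc _ _ _))

    coeff-scale : ∀ a x t → coeff S (scale S a x) t ≈ a * coeff S x t
    coeff-scale a [] t = ≈-sym (zeroʳ a)
    coeff-scale a ((s , b) ∷ x) t = ≈-trans (+-cong (if-* (does ((S ._≟_) s t))) (coeff-scale a x t)) (≈-sym (distribˡ a _ _))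
      where
      if-* : ∀ β → (if β then a * b else 0#) ≈ a * (if β then b else 0#)
      if-* true = ≈-refl
      if-* false = ≈-sym (zeroʳ a)

    coeff-concatMap-tabulate : ∀ {A : Set} {m} (h : A → V S) (g : Fin m → A) t →
      coeff S (concatMap h (tabulate g)) t ≈ sum (λ i → coeff S (h (g i)) t)
    coeff-concatMap-tabulate {m = zero} h g t = ≈-refl
    coeff-concatMap-tabulate {m = suc m} h g t =
      ≈-trans (coeff-++ (h (g zero)) _ t) (+-congˡ (coeff-concatMap-tabulate h (g ∘ suc) t))

    coeff-lc : ∀ {m} (a : Fin m → Carrier) (v : Fin m → V S) t → coeff S (lc S a v) t ≈ a · (λ i → coeff S (v i) t)
    coeff-lc a v t = ≈-trans (coeff-concatMap-tabulate (λ i → scale S (a i) (v i)) id t)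
      (sum-cong (λ i → coeff-scale (a i) (v i) t))

    coeff-e-≡ : ∀ {s t} → s ≡ t → coeff S e[ S ∣ s ] t ≈ 1#
    coeff-e-≡ {s} {t} s≡t = ≈-trans (+-identityʳ _) (≈-reflexive (cong (if_then 1# else 0#) (dec-true ((S ._≟_) s t) s≡t)))

    coeff-e-≢ : ∀ {s t} → s ≢ t → coeff S e[ S ∣ s ] t ≈ 0#
    coeff-e-≢ {s} {t} s≢t = ≈-trans (+-identityʳ _) (≈-reflexive (cong (if_then 1# else 0#) (dec-false ((S ._≟_) s t) s≢t)))

    coeff-singleton : ∀ s a t → coeff S ((s , a) ∷ []) t ≈ a * coeff S e[ S ∣ s ] t
    coeff-singleton s a t with does ((S ._≟_) s t)
    ... | true = ≈-trans (+-identityʳ a) (≈-sym (≈-trans (*-congˡ (+-identityʳ 1#)) (*-identityʳ a)))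
    ... | false = ≈-trans (+-identityʳ 0#) (≈-sym (≈-trans (*-congˡ (+-identityʳ 0#)) (zeroʳ a)))

    coeff-lc-zeros : ∀ {m} (a : Fin m → Carrier) (v : Fin m → V S) → (∀ j → a j ≈ 0#) → ∀ t → coeff S (lc S a v) t ≈ 0#
    coeff-lc-zeros a v a≈0 t = ≈-trans (coeff-lc a v t) (sum-zeros _ (λ j → ≈-trans (*-congʳ (a≈0 j)) (zeroˡ _)))

    coeff-lc-+ : ∀ {m} (a a′ : Fin m → Carrier) (v : Fin m → V S) t →
      coeff S (lc S (λ j → a j + a′ j) v) t ≈ coeff S (lc S a v) t + coeff S (lc S a′ v) t
    coeff-lc-+ a a′ v t = begin
      coeff S (lc S (λ j → a j + a′ j) v) t             ≈⟨ coeff-lc _ v t ⟩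
      sum (λ j → (a j + a′ j) * coeff S (v j) t)       ≈⟨ sum-cong (λ j → distribʳ (coeff S (v j) t) (a j) (a′ j)) ⟩
      sum (λ j → a j * coeff S (v j) t + a′ j * coeff S (v j) t)
        ≈⟨ ∑-distrib-+ (λ j → a j * coeff S (v j) t) (λ j → a′ j * coeff S (v j) t) ⟩
      a · (λ j → coeff S (v j) t) + a′ · (λ j → coeff S (v j) t)
        ≈⟨ ≈-sym (+-cong (coeff-lc a v t) (coeff-lc a′ v t)) ⟩
      coeff S (lc S a v) t + coeff S (lc S a′ v) t     ∎

    ++-regroup : ∀ (y y′ l l′ l″ z z′ z″ : V S) → Eq S y (l ++ z) → Eq S y′ (l′ ++ z′) →
      (∀ t → coeff S l″ t ≈ coeff S l t + coeff S l′ t) → (∀ t → coeff S z″ t ≈ coeff S z t + coeff S z′ t) →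
      Eq S (y ++ y′) (l″ ++ z″)
    ++-regroup y y′ l l′ l″ z z′ z″ y≈ y′≈ l″≈ z″≈ t = begin
      coeff S (y ++ y′) t                          ≈⟨ coeff-++ y y′ t ⟩
      coeff S y t + coeff S y′ t                   ≈⟨ +-cong (≈-trans (y≈ t) (coeff-++ l z t)) (≈-trans (y′≈ t) (coeff-++ l′ z′ t)) ⟩
      (coeff S l t + coeff S z t) + (coeff S l′ t + coeff S z′ t)
                                                   ≈⟨ +-interchange _ _ _ _ ⟩
      (coeff S l t + coeff S l′ t) + (coeff S z t + coeff S z′ t)
                                                   ≈⟨ ≈-sym (+-cong (l″≈ t) (z″≈ t)) ⟩
      coeff S l″ t + coeff S z″ t                  ≈⟨ ≈-sym (coeff-++ l″ z″ t) ⟩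
      coeff S (l″ ++ z″) t                         ∎

  module _ (S T : Based) (f : Idx S → V T) where

    ext-++ : ∀ x y → ext S T f (x ++ y) ≡ ext S T f x ++ ext S T f y
    ext-++ [] y = refl
    ext-++ ((s , a) ∷ x) y = ≡.trans (cong (scale T a (f s) ++_) (ext-++ x y))
      (≡.sym (ListP.++-assoc (scale T a (f s)) (ext S T f x) (ext S T f y)))

    coeff-ext-++ : ∀ x y t → coeff T (ext S T f (x ++ y)) t ≈ coeff T (ext S T f x) t + coeff T (ext S T f y) t
    coeff-ext-++ x y t = ≈-trans (≈-reflexive (cong (λ z → coeff T z t) (ext-++ x y))) (coeff-++ T (ext S T f x) (ext S T f y) t)

    coeff-ext-scale : ∀ a x t → coeff T (ext S T f (scale S a x)) t ≈ a * coeff T (ext S T f x) t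
    coeff-ext-scale a [] t = ≈-sym (zeroʳ a)
    coeff-ext-scale a ((s , b) ∷ x) t = begin
      coeff T (scale T (a * b) (f s) ++ ext S T f (scale S a x)) t
        ≈⟨ coeff-++ T (scale T (a * b) (f s)) _ t ⟩
      coeff T (scale T (a * b) (f s)) t + coeff T (ext S T f (scale S a x)) t
        ≈⟨ +-cong (coeff-scale T (a * b) (f s) t) (coeff-ext-scale a x t) ⟩
      (a * b) * coeff T (f s) t + a * coeff T (ext S T f x) t
        ≈⟨ +-congʳ (*-assoc a b _) ⟩
      a * (b * coeff T (f s) t) + a * coeff T (ext S T f x) t
        ≈⟨ ≈-sym (distribˡ a _ _) ⟩
      a * (b * coeff T (f s) t + coeff T (ext S T f x) t)
        ≈⟨ *-congˡ (≈-sym (≈-trans (coeff-++ T (scale T b (f s)) _ t) (+-congʳ (coeff-scale T b (f s) t)))) ⟩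
      a * coeff T (scale T b (f s) ++ ext S T f x) t ∎

    coeff-ext-concatMap-tabulate : ∀ {A : Set} {m} (h : A → V S) (g : Fin m → A) t →
      coeff T (ext S T f (concatMap h (tabulate g))) t ≈ sum (λ i → coeff T (ext S T f (h (g i))) t)
    coeff-ext-concatMap-tabulate {m = zero} h g t = ≈-refl
    coeff-ext-concatMap-tabulate {m = suc m} h g t =
      ≈-trans (coeff-ext-++ (h (g zero)) _ t) (+-congˡ (coeff-ext-concatMap-tabulate h (g ∘ suc) t))

    coeff-ext-lc : ∀ {m} (a : Fin m → Carrier) (v : Fin m → V S) t →
      coeff T (ext S T f (lc S a v)) t ≈ a · (λ i → coeff T (ext S T f (v i)) t)
    coeff-ext-lc a v t = ≈-trans (coeff-ext-concatMap-tabulate (λ i → scale S (a i) (v i)) id t)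
      (sum-cong (λ i → coeff-ext-scale (a i) (v i) t))

  module _ (S T : Based) (g : Idx S → Idx T) where

    pushforward : V S → V T
    pushforward = ext S T (λ s → e[ T ∣ g s ])

    coeff-pushforward-fibre : ∀ {t} s₀ → (∀ s → g s ≡ t ⇔ s ≡ s₀) → ∀ x →
      coeff T (pushforward x) t ≈ coeff S x s₀
    coeff-pushforward-fibre s₀ fibre [] = ≈-refl
    coeff-pushforward-fibre {t} s₀ fibre ((s , a) ∷ x) = +-cong entry (coeff-pushforward-fibre s₀ fibre x)
      where
      entry : (if does ((T ._≟_) (g s) t) then a * 1# else 0#) ≈ (if does ((S ._≟_) s s₀) then a else 0#)
      entry with (S ._≟_) s s₀
      ... | yes s≡s₀ rewrite dec-true ((T ._≟_) (g s) t) (from (fibre s) s≡s₀) = *-identityʳ a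
      ... | no s≢s₀ rewrite dec-false ((T ._≟_) (g s) t) (s≢s₀ ∘ to (fibre s)) = ≈-refl

    coeff-pushforward-singleton : ∀ s a t → coeff T (pushforward ((s , a) ∷ [])) t ≈ a * coeff T e[ T ∣ g s ] t
    coeff-pushforward-singleton s a t = ≈-trans (coeff-singleton T (g s) (a * 1#) t) (*-congʳ (*-identityʳ a))

    coeff-pushforward-∅ : ∀ {t} → (∀ s → g s ≢ t) → ∀ x → coeff T (pushforward x) t ≈ 0#
    coeff-pushforward-∅ no-fibre [] = ≈-refl
    coeff-pushforward-∅ {t} no-fibre ((s , a) ∷ x) = ≈-trans (+-congˡ (coeff-pushforward-∅ no-fibre x))
      (≈-trans (+-identityʳ _) (≈-reflexive (cong (if_then a * 1# else 0#) (dec-false ((T ._≟_) (g s) t) (no-fibre s)))))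

  module _ (S : Based) {m} (a : Fin m → Carrier) (g : Fin m → Idx S) where

    coeff-lc-basis-hit : ∀ i {s} → g i ≡ s → (∀ j → g j ≡ s → j ≡ i) →
      coeff S (lc S a (λ j → e[ S ∣ g j ])) s ≈ a i
    coeff-lc-basis-hit i gi≡s unique = ≈-trans (coeff-lc S a _ _)
      (≈-trans (sum-δ _ i (λ j j≢i → ≈-trans (*-congˡ (coeff-e-≢ S (j≢i ∘ unique j))) (zeroʳ _)))
               (≈-trans (*-congˡ (coeff-e-≡ S gi≡s)) (*-identityʳ _)))

    coeff-lc-basis-miss : ∀ {s} → (∀ j → g j ≢ s) → coeff S (lc S a (λ j → e[ S ∣ g j ])) s ≈ 0#
    coeff-lc-basis-miss miss = ≈-trans (coeff-lc S a _ _)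
      (sum-zeros _ (λ j → ≈-trans (*-congˡ (coeff-e-≢ S (miss j))) (zeroʳ _)))

  spanned-by-enumerated-basis : ∀ (S : Based) {A : Set} (key : Idx S → A) {Q : A → Set} → Decidable Q →
    ∀ {n} {E : Fin n → A} → Enumerates Q n E → (g : Fin n → Idx S) →
    (∀ i → key (g i) ≡ E i) → (∀ i s → E i ≡ key s → g i ≡ s) →
    (c : A → Carrier) → (∀ a → ¬ Q a → c a ≈ 0#) →
    ∀ x → (∀ s → coeff S x s ≈ c (key s)) → Eq S x (lc S (c ∘ E) (λ i → e[ S ∣ g i ]))
  spanned-by-enumerated-basis S key {Q} Q? {E = E} (valid , inj , surj) g key∘g≡E E≡key⇒g≡ c c≈0 x x≈c s
    with Q? (key s)
  ... | yes q = let i , Ei≡key = surj (key s) q in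
    ≈-trans (x≈c s) (≈-trans (≈-reflexive (cong c (≡.sym Ei≡key)))
      (≈-sym (coeff-lc-basis-hit S (c ∘ E) g i (E≡key⇒g≡ i s Ei≡key)
        (λ j gj≡s → inj (≡.trans (≡.trans (≡.sym (key∘g≡E j)) (cong key gj≡s)) (≡.sym Ei≡key))))))
  ... | no ¬q = ≈-trans (x≈c s) (≈-trans (c≈0 (key s) ¬q)
      (≈-sym (coeff-lc-basis-miss S (c ∘ E) g (λ j gj≡s → ¬q (subst Q (≡.trans (≡.sym (key∘g≡E j)) (cong key gj≡s)) (valid j))))))

  module Difference (S R T : Based) (f : Idx S → V T) (h : Idx R → V T) where

    δ : V S → V R → V T
    δ b r = ext S T f b ++ scale T (- 1#) (ext R T h r)

    coeff-δ : ∀ b r t → coeff T (δ b r) t ≈ coeff T (ext S T f b) t - coeff T (ext R T h r) t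
    coeff-δ b r t = ≈-trans (coeff-++ T (ext S T f b) _ t)
      (+-congˡ (≈-trans (coeff-scale T (- 1#) (ext R T h r) t) (-1*x≈-x _)))

    coeff-δ-++ : ∀ b b′ r r′ t → coeff T (δ (b ++ b′) (r ++ r′)) t ≈ coeff T (δ b r) t + coeff T (δ b′ r′) t
    coeff-δ-++ b b′ r r′ t = begin
      coeff T (δ (b ++ b′) (r ++ r′)) t   ≈⟨ coeff-δ (b ++ b′) (r ++ r′) t ⟩
      coeff T (ext S T f (b ++ b′)) t - coeff T (ext R T h (r ++ r′)) t
        ≈⟨ +-cong (coeff-ext-++ S T f b b′ t) (-‿cong (coeff-ext-++ R T h r r′ t)) ⟩
      (β + β′) - (ρ + ρ′)                 ≈⟨ +-congˡ (≈-sym (-‿+-comm ρ ρ′)) ⟩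
      (β + β′) + (- ρ + - ρ′)             ≈⟨ +-interchange β β′ (- ρ) (- ρ′) ⟩
      (β - ρ) + (β′ - ρ′)                 ≈⟨ ≈-sym (+-cong (coeff-δ b r t) (coeff-δ b′ r′ t)) ⟩
      coeff T (δ b r) t + coeff T (δ b′ r′) t ∎
      where
      β β′ ρ ρ′ : Carrier
      β = coeff T (ext S T f b) t
      β′ = coeff T (ext S T f b′) t
      ρ = coeff T (ext R T h r) t
      ρ′ = coeff T (ext R T h r′) t

    coeff-δ-lc : ∀ {m} (a : Fin m → Carrier) (v : Fin m → V S) (w : Fin m → V R) t →
      coeff T (δ (lc S a v) (lc R a w)) t ≈ a · (λ j → coeff T (δ (v j) (w j)) t)
    coeff-δ-lc a v w t = begin
      coeff T (δ (lc S a v) (lc R a w)) t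
        ≈⟨ coeff-δ (lc S a v) (lc R a w) t ⟩
      coeff T (ext S T f (lc S a v)) t - coeff T (ext R T h (lc R a w)) t
        ≈⟨ +-cong (coeff-ext-lc S T f a v t) (-‿cong (coeff-ext-lc R T h a w t)) ⟩
      a · (λ j → coeff T (ext S T f (v j)) t) - a · (λ j → coeff T (ext R T h (w j)) t)
        ≈⟨ ·-difference a _ _ ⟩
      a · (λ j → coeff T (ext S T f (v j)) t - coeff T (ext R T h (w j)) t)
        ≈⟨ sum-cong (λ j → *-congˡ (≈-sym (coeff-δ (v j) (w j) t))) ⟩
      a · (λ j → coeff T (δ (v j) (w j)) t) ∎

  module _ (D : KDiagram) where
    open KDiagram D

    ∂₁-lc : ∀ {m} (a : Fin m → Carrier) (v : Fin m → Dom D) t →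
      coeff A₁ (proj₁ (∂ D (lcD D a v))) t ≈ a · (λ j → coeff A₁ (proj₁ (∂ D (v j))) t)
    ∂₁-lc a v = Difference.coeff-δ-lc B₁ B₃ A₁ ρ₁₁ ρ₃₁ a (proj₁ ∘ v) (proj₂ ∘ proj₂ ∘ v)

    ∂₂-lc : ∀ {m} (a : Fin m → Carrier) (v : Fin m → Dom D) t →
      coeff A₂ (proj₂ (∂ D (lcD D a v))) t ≈ a · (λ j → coeff A₂ (proj₂ (∂ D (v j))) t)
    ∂₂-lc a v = Difference.coeff-δ-lc B₂ B₃ A₂ ρ₂₂ ρ₃₂ a (proj₁ ∘ proj₂ ∘ v) (proj₂ ∘ proj₂ ∘ v)

    _+D_ : Dom D → Dom D → Dom D
    (x₁ , x₂ , x₃) +D (x₁′ , x₂′ , x₃′) = x₁ ++ x₁′ , x₂ ++ x₂′ , x₃ ++ x₃′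

    ∂₁-+D : ∀ x x′ t → coeff A₁ (proj₁ (∂ D (x +D x′))) t ≈ coeff A₁ (proj₁ (∂ D x)) t + coeff A₁ (proj₁ (∂ D x′)) t
    ∂₁-+D (x₁ , _ , x₃) (x₁′ , _ , x₃′) = Difference.coeff-δ-++ B₁ B₃ A₁ ρ₁₁ ρ₃₁ x₁ x₁′ x₃ x₃′

    ∂₂-+D : ∀ x x′ t → coeff A₂ (proj₂ (∂ D (x +D x′))) t ≈ coeff A₂ (proj₂ (∂ D x)) t + coeff A₂ (proj₂ (∂ D x′)) t
    ∂₂-+D (_ , x₂ , x₃) (_ , x₂′ , x₃′) = Difference.coeff-δ-++ B₂ B₃ A₂ ρ₂₂ ρ₃₂ x₂ x₂′ x₃ x₃′

    InH⁰-lc : ∀ {m} (a : Fin m → Carrier) (v : Fin m → Dom D) → (∀ j → InH⁰ D (v j)) → InH⁰ D (lcD D a v)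
    InH⁰-lc a v v∈H⁰ =
      (λ t → ≈-trans (∂₁-lc a v t) (sum-zeros _ (λ j → ≈-trans (*-congˡ (proj₁ (v∈H⁰ j) t)) (zeroʳ _)))) ,
      (λ t → ≈-trans (∂₂-lc a v t) (sum-zeros _ (λ j → ≈-trans (*-congˡ (proj₂ (v∈H⁰ j) t)) (zeroʳ _))))

module PerfectMatching (W : Pt → ℤ) (π : ℤ → ℤ) (pm : IsPerfectMatching W π) where

  a₀ b₀ : ℤ
  a₀ = proj₁ (proj₁ pm)
  b₀ = proj₁ (proj₁ (proj₂ pm))

  private
    π-bijective : Bijective _≡_ _≡_ π
    π-bijective = proj₁ (proj₂ (proj₂ pm))
    matching : ∀ i j → (j ≡ π i → W (i , j) ≡ 1ℤ) × (¬ (j ≡ π i) → W (i , j) ≡ 0ℤ)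
    matching = proj₂ (proj₂ (proj₂ pm))

  π-injective : Injective _≡_ _≡_ π
  π-injective = proj₁ π-bijective

  π⁻¹ : ℤ → ℤ
  π⁻¹ y = proj₁ (proj₂ π-bijective y)

  π∘π⁻¹ : ∀ y → π (π⁻¹ y) ≡ y
  π∘π⁻¹ y = proj₂ (proj₂ π-bijective y) refl

  W-graph : ∀ i → W (i , π i) ≡ 1ℤ
  W-graph i = proj₁ (matching i (π i)) refl

  W≢0⇒graph : ∀ i j → W (i , j) ≢ 0ℤ → j ≡ π i
  W≢0⇒graph i j W≢0 with j ℤ.≟ π i
  ... | yes j≡πi = j≡πi
  ... | no j≢πi = ⊥-elim (W≢0 (proj₂ (matching i j) j≢πi))

  W≡1⇒graph : ∀ i j → W (i , j) ≡ 1ℤ → j ≡ π i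
  W≡1⇒graph i j W≡1 = W≢0⇒graph i j (≡1⇒≢0 W≡1)

  W≢0⇒W≡1 : ∀ p → W p ≢ 0ℤ → W p ≡ 1ℤ
  W≢0⇒W≡1 (i , j) W≢0 rewrite W≢0⇒graph i j W≢0 = W-graph i

  W-graph-≢0 : ∀ i → W (i , π i) ≢ 0ℤ
  W-graph-≢0 i = ≡1⇒≢0 (W-graph i)

  a₀<deg-graph : ∀ i → a₀ <ℤ i +ℤ π i
  a₀<deg-graph i = ℤP.≰⇒> λ deg≤a₀ → W-graph-≢0 i (proj₂ (proj₁ pm) (i , π i) deg≤a₀)

  deg-graph<b₀ : ∀ i → i +ℤ π i <ℤ b₀
  deg-graph<b₀ i = ℤP.≰⇒> λ b₀≤deg → W-graph-≢0 i (proj₂ (proj₁ (proj₂ pm)) (i , π i) b₀≤deg)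

  W-graph-multiplicity : ∀ u → MultiPred W (u , π u , 1)
  W-graph-multiplicity u = s≤s z≤n , ℤP.≤-reflexive (≡.sym (W-graph u))

  multi-point : ℤ → Idx (Multi-based W)
  multi-point u = (u , π u , 1) , W-graph-multiplicity u

  multi-point-surjective : ∀ (ix : Idx (Multi-based W)) → ix ≡ multi-point (proj₁ (proj₁ ix))
  multi-point-surjective ((s₁ , s₂ , i) , 1≤i , i≤W) with W≢0⇒graph s₁ s₂ W≢0
    where
    W≢0 : W (s₁ , s₂) ≢ 0ℤ
    W≢0 W≡0 = ℕP.<-irrefl refl (ℕP.≤-trans 1≤i (ℤP.drop‿+≤+ (subst (+ i ≤ℤ_) W≡0 i≤W)))
  ... | refl with ℕP.≤-antisym (ℤP.drop‿+≤+ (subst (+ i ≤ℤ_) (W-graph s₁) i≤W)) 1≤i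
  ... | refl = cong (_ ,_) (×-irr ℕP.≤-irrelevant ℤP.≤-irrelevant _ _)

  Below : Pt → ℤ → Set
  Below d = Box id π (proj₁ d) (proj₂ d)

  Above : Pt → ℤ → Set
  Above d = Cobox id π (proj₁ d) (proj₂ d)

  Below-bounded : ∀ d u → Below d u → (a₀ -ℤ proj₂ d ≤ℤ u) × (u ≤ℤ proj₁ d)
  Below-bounded (d₁ , d₂) u (u≤d₁ , πu≤d₂) =
    ≤-by-difference (solve 4 (λ u p a d → u :- (a :- d) := (u :+ p :+ d) :- (a :+ p)) refl u (π u) a₀ d₂)
      (ℤP.+-mono-≤ (ℤP.<⇒≤ (a₀<deg-graph u)) πu≤d₂) ,
    u≤d₁

  Above-bounded : ∀ d u → Above d u → (proj₁ d +ℤ 1ℤ ≤ℤ u) × (u ≤ℤ b₀ -ℤ proj₂ d)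
  Above-bounded (d₁ , d₂) u (d₁+1≤u , d₂+1≤πu) =
    d₁+1≤u ,
    ≤-by-difference (solve 4 (λ u p b d → (b :- d) :- u := (b :+ p) :- ((u :+ p) :+ d)) refl u (π u) b₀ d₂)
      (ℤP.+-mono-≤ (ℤP.<⇒≤ (deg-graph<b₀ u)) (ℤP.≤-trans (i≤i+1 d₂) d₂+1≤πu))

  -- Abstract so that the enumerations are never unfolded during type checking.
  abstract
    Below-enumerable : ∀ d → Enumerable (Below d)
    Below-enumerable d = enumerable-bounded (box? id π (proj₁ d) (proj₂ d)) _ _ (Below-bounded d)

    Above-enumerable : ∀ d → Enumerable (Above d)
    Above-enumerable d = enumerable-bounded (cobox? id π (proj₁ d) (proj₂ d)) _ _ (Above-bounded d)

  Below-empty : ∀ d → deg d ≤ℤ a₀ → ∀ u → ¬ Below d u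
  Below-empty d deg≤a₀ u (u≤d₁ , πu≤d₂) =
    ℤP.<-irrefl refl (ℤP.<-≤-trans (a₀<deg-graph u) (ℤP.≤-trans (ℤP.+-mono-≤ u≤d₁ πu≤d₂) deg≤a₀))

  Above-empty : ∀ d → b₀ ≤ℤ deg d → ∀ u → ¬ Above d u
  Above-empty d b₀≤deg u (d₁+1≤u , d₂+1≤πu) =
    ℤP.<-irrefl refl (ℤP.<-≤-trans (deg-graph<b₀ u)
      (ℤP.≤-trans b₀≤deg (ℤP.+-mono-≤ (ℤP.≤-trans (i≤i+1 (proj₁ d)) d₁+1≤u) (ℤP.≤-trans (i≤i+1 (proj₂ d)) d₂+1≤πu))))

  graph : ℤ → Pt
  graph i = (i , π i)

  on-graph-⇔ : (R : ℤ → ℤ → Set) → ∀ p →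
    ((W p ≡ 1ℤ) × R (proj₁ p) (proj₂ p)) ⇔ ((W p ≡ 1ℤ) × R (proj₁ p) (π (proj₁ p)))
  on-graph-⇔ R (i , j) = mk⇔ (λ (w , r) → w , subst (R i) (W≡1⇒graph i j w) r)
                              (λ (w , r) → w , subst (R i) (≡.sym (W≡1⇒graph i j w)) r)

  enumerates-graph : ∀ {Q : ℤ → Set} {P : Pt → Set} {n} {e : Fin n → ℤ} →
    (∀ p → P p ⇔ ((W p ≡ 1ℤ) × Q (proj₁ p))) → Enumerates Q n e → Enumerates P n (graph ∘ e)
  enumerates-graph {Q} {P} P⇔ = enumerates-image graph (cong proj₁) image
    where
    image : ∀ p → P p ⇔ (∃[ u ] (Q u × graph u ≡ p))
    image (i , j) = mk⇔ forth back
      where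
      forth : P (i , j) → ∃[ u ] (Q u × graph u ≡ (i , j))
      forth Pp with to (P⇔ (i , j)) Pp
      ... | W≡1 , Qi rewrite W≡1⇒graph i j W≡1 = i , Qi , refl
      back : ∃[ u ] (Q u × graph u ≡ (i , j)) → P (i , j)
      back (u , Qu , refl) = from (P⇔ (u , π u)) (W-graph u , Qu)

  N⁰ N¹ : Pt → ℕ
  N⁰ d = proj₁ (Below-enumerable d)
  N¹ d = proj₁ (Above-enumerable d)

  e⁰ : ∀ d → Fin (N⁰ d) → ℤ
  e⁰ d = proj₁ (proj₂ (Below-enumerable d))

  e¹ : ∀ d → Fin (N¹ d) → ℤ
  e¹ d = proj₁ (proj₂ (Above-enumerable d))

  e⁰-enumerates : ∀ d → Enumerates (Below d) (N⁰ d) (e⁰ d)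
  e⁰-enumerates d = proj₂ (proj₂ (Below-enumerable d))

  e¹-enumerates : ∀ d → Enumerates (Above d) (N¹ d) (e¹ d)
  e¹-enumerates d = proj₂ (proj₂ (Above-enumerable d))

  χ : Pt → ℤ
  χ d = + N⁰ d -ℤ + N¹ d

  χ-step₁ : ∀ d₁ d₂ → χ (d₁ +ℤ 1ℤ , d₂) ≡ χ (d₁ , d₂) +ℤ 1ℤ
  χ-step₁ d₁ d₂ = box-count-step id π d₁ d₂ (d₁ +ℤ 1ℤ) (λ _ a≡ → a≡) refl
    (e⁰-enumerates (d₁ , d₂)) (e¹-enumerates (d₁ , d₂)) (e⁰-enumerates (d₁ +ℤ 1ℤ , d₂)) (e¹-enumerates (d₁ +ℤ 1ℤ , d₂))

  χ-step₂ : ∀ d₁ d₂ → χ (d₁ , d₂ +ℤ 1ℤ) ≡ χ (d₁ , d₂) +ℤ 1ℤ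
  χ-step₂ d₁ d₂ = box-count-step π id d₂ d₁ (π⁻¹ (d₂ +ℤ 1ℤ))
    (λ a πa≡ → π-injective (≡.trans πa≡ (≡.sym (π∘π⁻¹ _)))) (π∘π⁻¹ _)
    (transposed (e⁰-enumerates (d₁ , d₂))) (transposed (e¹-enumerates (d₁ , d₂)))
    (transposed (e⁰-enumerates (d₁ , d₂ +ℤ 1ℤ))) (transposed (e¹-enumerates (d₁ , d₂ +ℤ 1ℤ)))
    where
    transposed : ∀ {A B : ℤ → Set} {n} {e : Fin n → ℤ} →
      Enumerates (λ a → A a × B a) n e → Enumerates (λ a → B a × A a) n e
    transposed = enumerates-⇔ (λ _ → mk⇔ swap swap)

  χ-translation : ∀ d → χ d ≡ deg d +ℤ χ 𝟎
  χ-translation (d₁ , d₂) = begin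
    χ (d₁ , d₂)              ≡⟨ step-by-one⇒translation (λ x → χ (x , d₂)) (λ x → χ-step₁ x d₂) d₁ ⟩
    d₁ +ℤ χ (0ℤ , d₂)         ≡⟨ cong (d₁ +ℤ_) (step-by-one⇒translation (λ y → χ (0ℤ , y)) (χ-step₂ 0ℤ) d₂) ⟩
    d₁ +ℤ (d₂ +ℤ χ 𝟎)         ≡⟨ ≡.sym (ℤP.+-assoc d₁ d₂ (χ 𝟎)) ⟩
    (d₁ +ℤ d₂) +ℤ χ 𝟎         ∎
    where open ≡.≡-Reasoning

module CohomologyOfM {c ℓ} (F : Field c ℓ) (W : Pt → ℤ) (π : ℤ → ℤ) (pm : IsPerfectMatching W π) where
  open Field F hiding (zero) renaming (refl to ≈-refl; sym to ≈-sym; trans to ≈-trans; reflexive to ≈-reflexive)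
  open FieldLinearAlgebra F
  open LinAlg F
  open Coordinates F
  open PerfectMatching W π pm

  private
    ℤ⊕ Multi : Based
    ℤ⊕ = ℤ-based
    Multi = Multi-based W

  first second : Idx Multi → ℤ
  first = proj₁ ∘ proj₁
  second = proj₁ ∘ proj₂ ∘ proj₁

  ≤-index-≡ : ∀ {m t t′} {p : t ≤ℤ m} {q : t′ ≤ℤ m} → t ≡ t′ → _≡_ {A = Idx (ℤ≤-based m)} (t , p) (t′ , q)
  ≤-index-≡ refl = cong (_ ,_) (ℤP.≤-irrelevant _ _)

  coeff-inclusion : ∀ {m} x {t} (t≤m : t ≤ℤ m) →
    coeff ℤ⊕ (pushforward (ℤ≤-based m) ℤ⊕ proj₁ x) t ≈ coeff (ℤ≤-based m) x (t , t≤m)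
  coeff-inclusion x {t} t≤m = coeff-pushforward-fibre _ ℤ⊕ proj₁ (t , t≤m)
    (λ _ → mk⇔ ≤-index-≡ (cong proj₁)) x

  coeff-inclusion-outside : ∀ {m} x {t} → ¬ t ≤ℤ m → coeff ℤ⊕ (pushforward (ℤ≤-based m) ℤ⊕ proj₁ x) t ≈ 0#
  coeff-inclusion-outside x t≰m = coeff-pushforward-∅ _ ℤ⊕ proj₁ (λ { (s , s≤m) refl → t≰m s≤m }) x

  coeff-first : ∀ x t → coeff ℤ⊕ (pushforward Multi ℤ⊕ first x) t ≈ coeff Multi x (multi-point t)
  coeff-first x t = coeff-pushforward-fibre Multi ℤ⊕ first (multi-point t)
    (λ ix → mk⇔ (λ { refl → multi-point-surjective ix }) (cong first)) x

  coeff-second : ∀ x u → coeff ℤ⊕ (pushforward Multi ℤ⊕ second x) (π u) ≈ coeff Multi x (multi-point u)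
  coeff-second x u = coeff-pushforward-fibre Multi ℤ⊕ second (multi-point u)
    (λ ix → mk⇔ (λ πu≡ → ≡.trans (multi-point-surjective ix) (cong multi-point (π-injective (≡.trans (second≡π ix) πu≡))))
                (λ { refl → refl })) x
    where
    second≡π : ∀ ix → π (first ix) ≡ second ix
    second≡π ix = ≡.sym (cong second (multi-point-surjective ix))

  module _ (d : Pt) where
    private
      D : KDiagram
      D = M W d
      B₁ B₂ : Based
      B₁ = ℤ≤-based (proj₁ d)
      B₂ = ℤ≤-based (proj₂ d)

    coeff-∂₁-pushforwards : ∀ x t → coeff ℤ⊕ (proj₁ (∂ D x)) t ≈
      coeff ℤ⊕ (pushforward B₁ ℤ⊕ proj₁ (proj₁ x)) t - coeff ℤ⊕ (pushforward Multi ℤ⊕ first (proj₂ (proj₂ x))) t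
    coeff-∂₁-pushforwards (x₁ , x₂ , x₃) = Difference.coeff-δ B₁ Multi ℤ⊕ _ _ x₁ x₃

    coeff-∂₂-pushforwards : ∀ x t → coeff ℤ⊕ (proj₂ (∂ D x)) t ≈
      coeff ℤ⊕ (pushforward B₂ ℤ⊕ proj₁ (proj₁ (proj₂ x))) t - coeff ℤ⊕ (pushforward Multi ℤ⊕ second (proj₂ (proj₂ x))) t
    coeff-∂₂-pushforwards (x₁ , x₂ , x₃) = Difference.coeff-δ B₂ Multi ℤ⊕ _ _ x₂ x₃

    coeff-∂₁ : ∀ x t → coeff ℤ⊕ (proj₁ (∂ D x)) t ≈
      coeff ℤ⊕ (pushforward B₁ ℤ⊕ proj₁ (proj₁ x)) t - coeff Multi (proj₂ (proj₂ x)) (multi-point t)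
    coeff-∂₁ x t = ≈-trans (coeff-∂₁-pushforwards x t) (+-congˡ (-‿cong (coeff-first (proj₂ (proj₂ x)) t)))

    coeff-∂₂ : ∀ x u → coeff ℤ⊕ (proj₂ (∂ D x)) (π u) ≈
      coeff ℤ⊕ (pushforward B₂ ℤ⊕ proj₁ (proj₁ (proj₂ x))) (π u) - coeff Multi (proj₂ (proj₂ x)) (multi-point u)
    coeff-∂₂ x u = ≈-trans (coeff-∂₂-pushforwards x (π u)) (+-congˡ (-‿cong (coeff-second (proj₂ (proj₂ x)) u)))

    kernel-equation₁ : ∀ x → InH⁰ D x → ∀ t →
      coeff ℤ⊕ (pushforward B₁ ℤ⊕ proj₁ (proj₁ x)) t ≈ coeff Multi (proj₂ (proj₂ x)) (multi-point t)
    kernel-equation₁ x x∈H⁰ t = x∙y⁻¹≈ε⇒x≈y _ _ (≈-trans (≈-sym (coeff-∂₁ x t)) (proj₁ x∈H⁰ t))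

    kernel-equation₂ : ∀ x → InH⁰ D x → ∀ u →
      coeff ℤ⊕ (pushforward B₂ ℤ⊕ proj₁ (proj₁ (proj₂ x))) (π u) ≈ coeff Multi (proj₂ (proj₂ x)) (multi-point u)
    kernel-equation₂ x x∈H⁰ u = x∙y⁻¹≈ε⇒x≈y _ _ (≈-trans (≈-sym (coeff-∂₂ x u)) (proj₂ x∈H⁰ (π u)))

    module H⁰ where

      n : ℕ
      n = N⁰ d

      E : Fin n → ℤ
      E = e⁰ d

      graph-enumerates : Enumerates (λ a → (W a ≡ 1ℤ) × (a ≤P d)) n (graph ∘ E)
      graph-enumerates = enumerates-graph (on-graph-⇔ (λ i j → (i ≤ℤ proj₁ d) × (j ≤ℤ proj₂ d))) (e⁰-enumerates d)

      W≡1 : ∀ i → W (graph (E i)) ≡ 1ℤ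
      W≡1 i = proj₁ (proj₁ graph-enumerates i)

      below : ∀ i → graph (E i) ≤P d
      below i = proj₂ (proj₁ graph-enumerates i)

      v : Fin n → Dom D
      v i = h⁰vec W d (graph (E i)) (W≡1 i) (below i)

      g₁ : Fin n → Idx B₁
      g₁ i = E i , proj₁ (below i)

      g₂ : Fin n → Idx B₂
      g₂ i = π (E i) , proj₂ (below i)

      g₃ : Fin n → Idx Multi
      g₃ i = (E i , π (E i) , 1) , s≤s z≤n , subst (+ 1 ≤ℤ_) (≡.sym (W≡1 i)) ℤP.≤-refl

      E-injective : ∀ {i j} → E i ≡ E j → i ≡ j
      E-injective = proj₁ (proj₂ (e⁰-enumerates d))

      -- Both components of ∂ (v i) are a vector minus itself.
      v∈H⁰ : ∀ i → InH⁰ D (v i)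
      v∈H⁰ i = (λ t → ≈-trans (coeff-∂₁-pushforwards (v i) t) (-‿inverseʳ _)) ,
               (λ t → ≈-trans (coeff-∂₂-pushforwards (v i) t) (-‿inverseʳ _))

      independent : ∀ a → _≈D_ D (lcD D a v) (0D D) → ∀ i → a i ≈ 0#
      independent a lc≈0 i = ≈-trans (≈-sym (coeff-lc-basis-hit B₁ a g₁ i refl (λ j gj≡gi → E-injective (cong proj₁ gj≡gi))))
                                     (proj₁ lc≈0 (g₁ i))

      φ : Dom D → Fin n → Carrier
      φ x i = coeff Multi (proj₂ (proj₂ x)) (multi-point (E i))

      -- The kernel equations identify the B₁- and B₂-coefficients of x with its B₃-coefficients γ
      -- at the graph points, and force γ to vanish outside Below d.
      spans : ∀ x → InH⁰ D x → _≈D_ D x (lcD D (φ x) v)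
      spans x@(x₁ , x₂ , x₃) x∈H⁰ =
        span B₁ proj₁ g₁ (λ _ → refl) (λ { i (t , _) Ei≡t → ≤-index-≡ Ei≡t }) x₁
          (λ (t , t≤d₁) → ≈-trans (≈-sym (coeff-inclusion x₁ t≤d₁)) (kernel-equation₁ x x∈H⁰ t)) ,
        span B₂ (π⁻¹ ∘ proj₁) g₂ (λ i → π-injective (π∘π⁻¹ (π (E i))))
          (λ { i (t , _) Ei≡π⁻¹t → ≤-index-≡ (≡.trans (cong π Ei≡π⁻¹t) (π∘π⁻¹ t)) }) x₂
          (λ (t , t≤d₂) → ≈-trans (≈-sym (coeff-inclusion x₂ t≤d₂))
            (≈-trans (≈-reflexive (cong (coeff ℤ⊕ (pushforward B₂ ℤ⊕ proj₁ x₂)) (≡.sym (π∘π⁻¹ t))))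
                     (kernel-equation₂ x x∈H⁰ (π⁻¹ t)))) ,
        span Multi first g₃ (λ _ → refl)
          (λ i ix Ei≡ → ≡.trans (multi-point-surjective (g₃ i)) (≡.trans (cong multi-point Ei≡) (≡.sym (multi-point-surjective ix)))) x₃
          (λ ix → ≈-reflexive (cong (coeff Multi x₃) (multi-point-surjective ix)))
        where
        γ : ℤ → Carrier
        γ u = coeff Multi x₃ (multi-point u)
        γ≈0 : ∀ u → ¬ Below d u → γ u ≈ 0#
        γ≈0 u ¬below with u ℤP.≤? proj₁ d
        ... | no u≰d₁ = ≈-trans (≈-sym (kernel-equation₁ x x∈H⁰ u)) (coeff-inclusion-outside x₁ u≰d₁)
        ... | yes u≤d₁ = ≈-trans (≈-sym (kernel-equation₂ x x∈H⁰ u))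
                           (coeff-inclusion-outside x₂ (λ πu≤d₂ → ¬below (u≤d₁ , πu≤d₂)))
        span : ∀ S (key : Idx S → ℤ) g → (∀ i → key (g i) ≡ E i) → (∀ i s → E i ≡ key s → g i ≡ s) →
          ∀ y → (∀ s → coeff S y s ≈ γ (key s)) → Eq S y (lc S (γ ∘ E) (λ i → e[ S ∣ g i ]))
        span S key g key∘g≡E E≡key⇒g≡ = spanned-by-enumerated-basis S key (box? id π (proj₁ d) (proj₂ d))
          (e⁰-enumerates d) g key∘g≡E E≡key⇒g≡ γ γ≈0

      basis : IsH⁰Basis D n v
      basis = v∈H⁰ , independent , λ x x∈H⁰ → φ x , spans x x∈H⁰

      φ-lc : ∀ {m} (a : Fin m → Carrier) (w : Fin m → Dom D) l → φ (lcD D a w) l ≈ a · (λ j → φ (w j) l)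
      φ-lc a w l = coeff-lc Multi a (proj₂ ∘ proj₂ ∘ w) (multi-point (E l))

      φ-v-≡ : ∀ i → φ (v i) i ≈ 1#
      φ-v-≡ i = coeff-e-≡ Multi (multi-point-surjective (g₃ i))

      φ-v-≢ : ∀ i l → i ≢ l → φ (v i) l ≈ 0#
      φ-v-≢ i l i≢l = coeff-e-≢ Multi (i≢l ∘ E-injective ∘ cong first)

      dimension-unique : ∀ n′ → b⁰≡ D n′ → n′ ≡ n
      dimension-unique n′ (v′ , v′∈H⁰ , independent′ , spans′) =
        kernelFree∧biorthogonal⇒≡ A B A-kernelFree
          ((λ i → ≈-trans (B·A i i) (φ-v-≡ i)) , (λ i l i≢l → ≈-trans (B·A i l) (φ-v-≢ i l i≢l)))
        where
        A B : Matrix n n′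
        A l j = φ (v′ j) l
        B i = proj₁ (spans′ (v i) (v∈H⁰ i))
        A-kernelFree : KernelFree A
        A-kernelFree x Ax≈0 = independent′ x
          ((λ t → ≈-trans (proj₁ y≈ t) (coeff-lc-zeros B₁ (φ y) _ φy≈0 t)) ,
           (λ t → ≈-trans (proj₁ (proj₂ y≈) t) (coeff-lc-zeros B₂ (φ y) _ φy≈0 t)) ,
           (λ t → ≈-trans (proj₂ (proj₂ y≈) t) (coeff-lc-zeros Multi (φ y) _ φy≈0 t)))
          where
          y : Dom D
          y = lcD D x v′
          y≈ : _≈D_ D y (lcD D (φ y) v)
          y≈ = spans y (InH⁰-lc D x v′ v′∈H⁰)
          φy≈0 : ∀ l → φ y l ≈ 0#
          φy≈0 l = ≈-trans (φ-lc x v′ l) (≈-trans (·-comm x (A l)) (Ax≈0 l))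
        B·A : ∀ i l → B i · A l ≈ φ (v i) l
        B·A i l = ≈-sym (≈-trans (proj₂ (proj₂ (proj₂ (spans′ (v i) (v∈H⁰ i)))) (multi-point (E l))) (φ-lc (B i) v′ l))

    module H¹ where
      open import Relation.Binary.Reasoning.Setoid setoid

      n : ℕ
      n = N¹ d

      E : Fin n → ℤ
      E = e¹ d

      E-injective : ∀ {i j} → E i ≡ E j → i ≡ j
      E-injective = proj₁ (proj₂ (e¹-enumerates d))

      above : ∀ i → Above d (E i)
      above = proj₁ (e¹-enumerates d)

      graph-enumerates : Enumerates (λ a → (W a ≡ 1ℤ) × ((d ⊕ 𝟏) ≤P a)) n (graph ∘ E)
      graph-enumerates = enumerates-graph (on-graph-⇔ (λ i j → (proj₁ d +ℤ 1ℤ ≤ℤ i) × (proj₂ d +ℤ 1ℤ ≤ℤ j))) (e¹-enumerates d)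

      u : Fin n → Cod D
      u i = h¹vec W d (E i)

      ψ : Cod D → Fin n → Carrier
      ψ y l = coeff ℤ⊕ (proj₁ y) (E l) - coeff ℤ⊕ (proj₂ y) (π (E l))

      -- Above d, both pushforwards from B₁ and B₂ vanish, so only the B₃-coefficient
      -- at the graph point remains, once in each component.
      ψ-∂ : ∀ x l → ψ (∂ D x) l ≈ 0#
      ψ-∂ x l = ≈-trans (+-cong (only-B₃ (coeff-∂₁ x (E l)) (coeff-inclusion-outside (proj₁ x) (+1≤⇒≰ (proj₁ (above l)))))
                                (-‿cong (only-B₃ (coeff-∂₂ x (E l)) (coeff-inclusion-outside (proj₁ (proj₂ x)) (+1≤⇒≰ (proj₂ (above l)))))))
                        (-‿inverseʳ _)
        where
        only-B₃ : ∀ {z p c} → z ≈ p - c → p ≈ 0# → z ≈ - c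
        only-B₃ z≈ p≈0 = ≈-trans z≈ (≈-trans (+-congʳ p≈0) (+-identityˡ _))

      ψ-lc : ∀ {m} (a : Fin m → Carrier) (w : Fin m → Cod D) l → ψ (lcC D a w) l ≈ a · (λ j → ψ (w j) l)
      ψ-lc a w l = ≈-trans (+-cong (coeff-lc ℤ⊕ a (proj₁ ∘ w) (E l)) (-‿cong (coeff-lc ℤ⊕ a (proj₂ ∘ w) (π (E l)))))
                           (·-difference a _ _)

      ψ-+ : ∀ y y′ l → ψ (_+C_ D y y′) l ≈ ψ y l + ψ y′ l
      ψ-+ (y₁ , y₂) (y₁′ , y₂′) l = begin
        coeff ℤ⊕ (y₁ ++ y₁′) t - coeff ℤ⊕ (y₂ ++ y₂′) πt
          ≈⟨ +-cong (coeff-++ ℤ⊕ y₁ y₁′ t) (-‿cong (coeff-++ ℤ⊕ y₂ y₂′ πt)) ⟩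
        (coeff ℤ⊕ y₁ t + coeff ℤ⊕ y₁′ t) - (coeff ℤ⊕ y₂ πt + coeff ℤ⊕ y₂′ πt)
          ≈⟨ +-congˡ (≈-sym (-‿+-comm _ _)) ⟩
        (coeff ℤ⊕ y₁ t + coeff ℤ⊕ y₁′ t) + (- coeff ℤ⊕ y₂ πt + - coeff ℤ⊕ y₂′ πt)
          ≈⟨ +-interchange _ _ _ _ ⟩
        ψ (y₁ , y₂) l + ψ (y₁′ , y₂′) l ∎
        where
        t πt : ℤ
        t = E l
        πt = π (E l)

      ψ-cong : ∀ {y y′} → _≈C_ D y y′ → ∀ l → ψ y l ≈ ψ y′ l
      ψ-cong (y₁≈ , y₂≈) l = +-cong (y₁≈ (E l)) (-‿cong (y₂≈ (π (E l))))

      ψ-u-≡ : ∀ i → ψ (u i) i ≈ 1#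
      ψ-u-≡ i = ≈-trans (+-cong (coeff-e-≡ ℤ⊕ {E i} refl) -0#≈0#) (+-identityʳ 1#)

      ψ-u-≢ : ∀ i l → i ≢ l → ψ (u i) l ≈ 0#
      ψ-u-≢ i l i≢l = ≈-trans (+-cong (coeff-e-≢ ℤ⊕ (i≢l ∘ E-injective)) -0#≈0#) (+-identityʳ 0#)

      ·-ψ-u : ∀ (a : Fin n → Carrier) l → a · (λ j → ψ (u j) l) ≈ a l
      ·-ψ-u a l = ≈-trans (sum-δ _ l (λ j j≢l → ≈-trans (*-congˡ (ψ-u-≢ j l j≢l)) (zeroʳ _)))
                          (≈-trans (*-congˡ (ψ-u-≡ l)) (*-identityʳ _))

      independent : ∀ a x → _≈C_ D (lcC D a u) (∂ D x) → ∀ i → a i ≈ 0#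
      independent a x lc≈∂ i = begin
        a i                            ≈⟨ ≈-sym (·-ψ-u a i) ⟩
        a · (λ j → ψ (u j) i)          ≈⟨ ≈-sym (ψ-lc a u i) ⟩
        ψ (lcC D a u) i                ≈⟨ ψ-cong {lcC D a u} {∂ D x} lc≈∂ i ⟩
        ψ (∂ D x) i                    ≈⟨ ψ-∂ x i ⟩
        0#                             ∎

      Spanned : Cod D → Set (c ⊔ ℓ)
      Spanned y = ∃[ a ] ∃[ x ] (_≈C_ D y (_+C_ D (lcC D a u) (∂ D x)))

      spanned-resp : ∀ {y y′} → _≈C_ D y y′ → Spanned y′ → Spanned y
      spanned-resp (y₁≈ , y₂≈) (a , x , y′₁≈ , y′₂≈) =
        a , x , (λ t → ≈-trans (y₁≈ t) (y′₁≈ t)) , (λ t → ≈-trans (y₂≈ t) (y′₂≈ t))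

      spanned-∂ : ∀ x → Spanned (∂ D x)
      spanned-∂ x = (λ _ → 0#) , x , only-∂ (proj₁ ∘ u) (proj₁ (∂ D x)) , only-∂ (proj₂ ∘ u) (proj₂ (∂ D x))
        where
        only-∂ : ∀ w z → Eq ℤ⊕ z (lc ℤ⊕ (λ _ → 0#) w ++ z)
        only-∂ w z t = ≈-sym (≈-trans (coeff-++ ℤ⊕ (lc ℤ⊕ (λ _ → 0#) w) z t)
          (≈-trans (+-congʳ (coeff-lc-zeros ℤ⊕ _ w (λ _ → ≈-refl) t)) (+-identityˡ _)))

      spanned-lc : ∀ a → Spanned (lcC D a u)
      spanned-lc a = a , 0D D , only-lc (proj₁ ∘ u) , only-lc (proj₂ ∘ u)
        where
        only-lc : ∀ w → Eq ℤ⊕ (lc ℤ⊕ a w) (lc ℤ⊕ a w ++ [])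
        only-lc w t = ≈-sym (≈-trans (coeff-++ ℤ⊕ (lc ℤ⊕ a w) [] t) (+-identityʳ _))

      spanned-+ : ∀ {y y′} → Spanned y → Spanned y′ → Spanned (_+C_ D y y′)
      spanned-+ {y} {y′} (a , x , y₁≈ , y₂≈) (a′ , x′ , y′₁≈ , y′₂≈) =
        (λ j → a j + a′ j) , _+D_ D x x′ , regroup proj₁ (∂₁-+D D x x′) y₁≈ y′₁≈ , regroup proj₂ (∂₂-+D D x x′) y₂≈ y′₂≈
        where
        regroup : (p : Cod D → V ℤ⊕) →
          (∀ t → coeff ℤ⊕ (p (∂ D (_+D_ D x x′))) t ≈ coeff ℤ⊕ (p (∂ D x)) t + coeff ℤ⊕ (p (∂ D x′)) t) →
          Eq ℤ⊕ (p y) (lc ℤ⊕ a (p ∘ u) ++ p (∂ D x)) → Eq ℤ⊕ (p y′) (lc ℤ⊕ a′ (p ∘ u) ++ p (∂ D x′)) →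
          Eq ℤ⊕ (p y ++ p y′) (lc ℤ⊕ (λ j → a j + a′ j) (p ∘ u) ++ p (∂ D (_+D_ D x x′)))
        regroup p ∂-+D y≈ y′≈ = ++-regroup ℤ⊕ (p y) (p y′) (lc ℤ⊕ a (p ∘ u)) (lc ℤ⊕ a′ (p ∘ u)) (lc ℤ⊕ (λ j → a j + a′ j) (p ∘ u))
          (p (∂ D x)) (p (∂ D x′)) (p (∂ D (_+D_ D x x′))) y≈ y′≈ (coeff-lc-+ ℤ⊕ a a′ (p ∘ u)) ∂-+D

      -- e_t is a boundary when t ≤ d₁ or π t ≤ d₂, and one of the u otherwise.
      spanned-A₁-generator : ∀ t a → Spanned (((t , a) ∷ []) , [])
      spanned-A₁-generator t a with t ℤP.≤? proj₁ d | π t ℤP.≤? proj₂ d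
      ... | yes t≤d₁ | _ = spanned-resp {((t , a) ∷ []) , []} {∂ D x} (boundary , λ _ → ≈-refl) (spanned-∂ x)
        where
        x : Dom D
        x = (((t , t≤d₁) , a) ∷ []) , [] , []
        boundary : ∀ s → coeff ℤ⊕ ((t , a) ∷ []) s ≈ coeff ℤ⊕ (proj₁ (∂ D x)) s
        boundary s = ≈-trans (coeff-singleton ℤ⊕ t a s) (≈-sym (≈-trans (coeff-∂₁-pushforwards x s)
          (≈-trans (+-cong (coeff-pushforward-singleton B₁ ℤ⊕ proj₁ (t , t≤d₁) a s) -0#≈0#) (+-identityʳ _))))
      ... | no t≰d₁ | yes πt≤d₂ = spanned-resp {((t , a) ∷ []) , []} {∂ D x} (boundary₁ , boundary₂) (spanned-∂ x)
        where
        x : Dom D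
        x = [] , (((π t , πt≤d₂) , - a) ∷ []) , ((multi-point t , - a) ∷ [])
        boundary₁ : ∀ s → coeff ℤ⊕ ((t , a) ∷ []) s ≈ coeff ℤ⊕ (proj₁ (∂ D x)) s
        boundary₁ s = ≈-trans (coeff-singleton ℤ⊕ t a s) (≈-sym (≈-trans (coeff-∂₁-pushforwards x s)
          (≈-trans (+-congˡ (-‿cong (coeff-pushforward-singleton Multi ℤ⊕ first (multi-point t) (- a) s))) (0-[-x*y]≈x*y a _))))
        boundary₂ : ∀ s → 0# ≈ coeff ℤ⊕ (proj₂ (∂ D x)) s
        boundary₂ s = ≈-sym (≈-trans (coeff-∂₂-pushforwards x s)
          (≈-trans (+-cong (coeff-pushforward-singleton B₂ ℤ⊕ proj₁ (π t , πt≤d₂) (- a) s)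
                           (-‿cong (coeff-pushforward-singleton Multi ℤ⊕ second (multi-point t) (- a) s)))
                   (-‿inverseʳ _)))
      ... | no t≰d₁ | no πt≰d₂ = spanned-resp {((t , a) ∷ []) , []} {lcC D (single i a) u} (combination₁ , combination₂) (spanned-lc (single i a))
        where
        i : Fin n
        i = proj₁ (proj₂ (proj₂ (e¹-enumerates d)) t (≰⇒+1≤ t≰d₁ , ≰⇒+1≤ πt≰d₂))
        Ei≡t : E i ≡ t
        Ei≡t = proj₂ (proj₂ (proj₂ (e¹-enumerates d)) t (≰⇒+1≤ t≰d₁ , ≰⇒+1≤ πt≰d₂))
        combination₁ : ∀ s → coeff ℤ⊕ ((t , a) ∷ []) s ≈ coeff ℤ⊕ (lc ℤ⊕ (single i a) (proj₁ ∘ u)) s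
        combination₁ s = ≈-trans (coeff-singleton ℤ⊕ t a s) (≈-sym (≈-trans (coeff-lc ℤ⊕ (single i a) (proj₁ ∘ u) s)
          (≈-trans (single-· i a _) (≈-reflexive (cong (λ z → a * coeff ℤ⊕ e[ ℤ⊕ ∣ z ] s) Ei≡t)))))
        combination₂ : ∀ s → 0# ≈ coeff ℤ⊕ (lc ℤ⊕ (single i a) (proj₂ ∘ u)) s
        combination₂ s = ≈-sym (≈-trans (coeff-lc ℤ⊕ (single i a) (proj₂ ∘ u) s) (sum-zeros (λ j → single i a j * 0#) (λ j → zeroʳ _)))

      -- For t > d₂ and w = π⁻¹ t, (0 , e_t) = (- e_w , 0) + ∂ (0 , 0 , - e_(w,t,1)) reduces to A₁.
      spanned-A₂-generator : ∀ t a → Spanned ([] , ((t , a) ∷ []))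
      spanned-A₂-generator t a with t ℤP.≤? proj₂ d
      ... | yes t≤d₂ = spanned-resp {[] , ((t , a) ∷ [])} {∂ D x} ((λ _ → ≈-refl) , boundary) (spanned-∂ x)
        where
        x : Dom D
        x = [] , (((t , t≤d₂) , a) ∷ []) , []
        boundary : ∀ s → coeff ℤ⊕ ((t , a) ∷ []) s ≈ coeff ℤ⊕ (proj₂ (∂ D x)) s
        boundary s = ≈-trans (coeff-singleton ℤ⊕ t a s) (≈-sym (≈-trans (coeff-∂₂-pushforwards x s)
          (≈-trans (+-cong (coeff-pushforward-singleton B₂ ℤ⊕ proj₁ (t , t≤d₂) a s) -0#≈0#) (+-identityʳ _))))
      ... | no t≰d₂ = spanned-resp {[] , ((t , a) ∷ [])} {_+C_ D (((w , - a) ∷ []) , []) (∂ D x)} (cancel , boundary)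
          (spanned-+ {((w , - a) ∷ []) , []} {∂ D x} (spanned-A₁-generator w (- a)) (spanned-∂ x))
        where
        w : ℤ
        w = π⁻¹ t
        x : Dom D
        x = [] , [] , ((multi-point w , - a) ∷ [])
        cancel : ∀ s → 0# ≈ coeff ℤ⊕ ((w , - a) ∷ proj₁ (∂ D x)) s
        cancel s = ≈-sym (≈-trans (coeff-++ ℤ⊕ ((w , - a) ∷ []) (proj₁ (∂ D x)) s)
          (≈-trans (+-cong (coeff-singleton ℤ⊕ w (- a) s) (≈-trans (coeff-∂₁-pushforwards x s)
                   (≈-trans (+-congˡ (-‿cong (coeff-pushforward-singleton Multi ℤ⊕ first (multi-point w) (- a) s))) (+-identityˡ _))))
                   (-‿inverseʳ _)))
        boundary : ∀ s → coeff ℤ⊕ ((t , a) ∷ []) s ≈ coeff ℤ⊕ (proj₂ (∂ D x)) s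
        boundary s = ≈-trans (coeff-singleton ℤ⊕ t a s) (≈-sym (≈-trans (coeff-∂₂-pushforwards x s)
          (≈-trans (+-congˡ (-‿cong (coeff-pushforward-singleton Multi ℤ⊕ second (multi-point w) (- a) s)))
          (≈-trans (0-[-x*y]≈x*y a _) (≈-reflexive (cong (λ z → a * coeff ℤ⊕ e[ ℤ⊕ ∣ z ] s) (π∘π⁻¹ t)))))))

      spanned-all : ∀ y → Spanned y
      spanned-all (y₁ , y₂) = along-A₁ y₁
        where
        along-A₂ : ∀ y₂ → Spanned ([] , y₂)
        along-A₂ [] = spanned-∂ (0D D)
        along-A₂ ((t , a) ∷ y₂) = spanned-+ {[] , ((t , a) ∷ [])} {[] , y₂} (spanned-A₂-generator t a) (along-A₂ y₂)
        along-A₁ : ∀ y₁ → Spanned (y₁ , y₂)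
        along-A₁ [] = along-A₂ y₂
        along-A₁ ((t , a) ∷ y₁) = spanned-+ {((t , a) ∷ []) , []} {y₁ , y₂} (spanned-A₁-generator t a) (along-A₁ y₁)

      basis : IsH¹Basis D n u
      basis = independent , spanned-all

      ψ-modulo-∂ : ∀ {m} y (a : Fin m → Carrier) w x → _≈C_ D y (_+C_ D (lcC D a w) (∂ D x)) →
        ∀ l → ψ y l ≈ a · (λ j → ψ (w j) l)
      ψ-modulo-∂ y a w x y≈ l = begin
        ψ y l                                   ≈⟨ ψ-cong {y} {_+C_ D (lcC D a w) (∂ D x)} y≈ l ⟩
        ψ (_+C_ D (lcC D a w) (∂ D x)) l        ≈⟨ ψ-+ (lcC D a w) (∂ D x) l ⟩
        ψ (lcC D a w) l + ψ (∂ D x) l           ≈⟨ +-cong (ψ-lc a w l) (ψ-∂ x l) ⟩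
        a · (λ j → ψ (w j) l) + 0#              ≈⟨ +-identityʳ _ ⟩
        a · (λ j → ψ (w j) l)                   ∎

      dimension-unique : ∀ n′ → b¹≡ D n′ → n′ ≡ n
      dimension-unique n′ (u′ , independent′ , spans′) =
        kernelFree∧biorthogonal⇒≡ A B A-kernelFree
          ((λ i → ≈-trans (B·A i i) (ψ-u-≡ i)) , (λ i l i≢l → ≈-trans (B·A i l) (ψ-u-≢ i l i≢l)))
        where
        A B : Matrix n n′
        A l j = ψ (u′ j) l
        B i = proj₁ (spans′ (u i))
        B·A : ∀ i l → B i · A l ≈ ψ (u i) l
        B·A i l = let x , u≈ = proj₂ (spans′ (u i)) in ≈-sym (ψ-modulo-∂ (u i) (B i) u′ x u≈ l)
        A-kernelFree : KernelFree A
        A-kernelFree x Ax≈0 = independent′ x z (only-∂ proj₁ (proj₁ y≈) , only-∂ proj₂ (proj₂ y≈))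
          where
          y : Cod D
          y = lcC D x u′
          a : Fin n → Carrier
          a = proj₁ (spanned-all y)
          z : Dom D
          z = proj₁ (proj₂ (spanned-all y))
          y≈ : _≈C_ D y (_+C_ D (lcC D a u) (∂ D z))
          y≈ = proj₂ (proj₂ (spanned-all y))
          a≈0 : ∀ l → a l ≈ 0#
          a≈0 l = begin
            a l                          ≈⟨ ≈-sym (·-ψ-u a l) ⟩
            a · (λ j → ψ (u j) l)        ≈⟨ ≈-sym (ψ-modulo-∂ y a u z y≈ l) ⟩
            ψ y l                        ≈⟨ ψ-lc x u′ l ⟩
            x · A l                      ≈⟨ ·-comm x (A l) ⟩
            A l · x                      ≈⟨ Ax≈0 l ⟩
            0#                           ∎
          only-∂ : (p : Cod D → V ℤ⊕) → Eq ℤ⊕ (p y) (lc ℤ⊕ a (p ∘ u) ++ p (∂ D z)) → Eq ℤ⊕ (p y) (p (∂ D z))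
          only-∂ p p-y≈ t = ≈-trans (p-y≈ t) (≈-trans (coeff-++ ℤ⊕ (lc ℤ⊕ a (p ∘ u)) (p (∂ D z)) t)
            (≈-trans (+-congʳ (coeff-lc-zeros ℤ⊕ a (p ∘ u) a≈0 t)) (+-identityˡ _)))

  b⁰-vanishes : ∀ d → deg d ≤ℤ a₀ → b⁰≡ (M W d) 0
  b⁰-vanishes d deg≤a₀ =
    subst (b⁰≡ (M W d)) (enumerates-∅⇒0 (Below-empty d deg≤a₀) (e⁰-enumerates d)) (H⁰.v d , H⁰.basis d)

  b¹-vanishes : ∀ d → b₀ ≤ℤ deg d → b¹≡ (M W d) 0
  b¹-vanishes d b₀≤deg =
    subst (b¹≡ (M W d)) (enumerates-∅⇒0 (Above-empty d b₀≤deg) (e¹-enumerates d)) (H¹.u d , H¹.basis d)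

  euler-characteristic : ∀ d n₀ n₁ → b⁰≡ (M W d) n₀ → b¹≡ (M W d) n₁ → (+ n₀ -ℤ + n₁) ≡ deg d +ℤ χ 𝟎
  euler-characteristic d n₀ n₁ b⁰ b¹ =
    ≡.trans (cong₂ (λ m₀ m₁ → + m₀ -ℤ + m₁) (H⁰.dimension-unique d n₀ b⁰) (H¹.dimension-unique d n₁ b¹)) (χ-translation d)

  b¹-via-b⁰ : ∀ K d n₀ n₁ → b⁰≡ (M W (K ⊖ (K ⊖ d))) n₀ → b¹≡ (M W d) n₁ →
    + n₁ ≡ (+ n₀ -ℤ deg (K ⊖ (K ⊖ d))) -ℤ χ 𝟎
  b¹-via-b⁰ K d n₀ n₁ b⁰ b¹ = begin
    + n₁                          ≡⟨ solve 2 (λ a b → b := a :- (a :- b)) refl (+ n₀) (+ n₁) ⟩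
    + n₀ -ℤ (+ n₀ -ℤ + n₁)        ≡⟨ cong (+ n₀ -ℤ_) (euler-characteristic d′ n₀ n₁ b⁰ b¹′) ⟩
    + n₀ -ℤ (deg d′ +ℤ χ 𝟎)       ≡⟨ solve 3 (λ a g C → a :- (g :+ C) := (a :- g) :- C) refl (+ n₀) (deg d′) (χ 𝟎) ⟩
    (+ n₀ -ℤ deg d′) -ℤ χ 𝟎       ∎
    where
    open ≡.≡-Reasoning
    d′ : Pt
    d′ = K ⊖ (K ⊖ d)
    b¹′ : b¹≡ (M W d′) n₁
    b¹′ = subst (λ p → b¹≡ (M W p) n₁) (≡.sym (⊖-involutive K d)) b¹

  b¹-sumBelow-dual : ∀ K d n₁ → b¹≡ (M W d) n₁ → SumBelow (dual (K ⊕ 𝟏) W) (K ⊖ d) (+ n₁)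
  b¹-sumBelow-dual K d n₁ b¹ rewrite H¹.dimension-unique d n₁ b¹ =
    sumBelow-enumeration (dual (K ⊕ 𝟏) W) (K ⊖ d) (λ p → W≢0⇒W≡1 ((K ⊕ 𝟏) ⊖ p)) (enumerates-dual W K d (H¹.graph-enumerates d))

theorem4p14 : ∀ {c ℓ} (k : Field c ℓ) (W : Pt → ℤ) (π : ℤ → ℤ) → IsPerfectMatching W π →
    let open LinAlg k in
    -- (1),(2): H⁰ has the stated basis indexed by {a | W a = 1, a ≤ d}; b⁰ = #{…} = (𝔰W)(d)
    (∀ d → ∃[ n ] Σ (Fin n → Pt) λ e → Σ (Enumerates (λ a → (W a ≡ 1ℤ) × (a ≤P d)) n e) λ en →
        IsH⁰Basis (M W d) n (λ i → h⁰vec W d (e i) (proj₁ (proj₁ en i)) (proj₂ (proj₁ en i))) ×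
        b⁰≡ (M W d) n × SumBelow W d (+ n)) ×
    -- (3): b¹ = #{a | W a = 1, a ≥ d + 1}
    (∀ d → ∃[ n ] Σ (Fin n → Pt) λ e →
        Enumerates (λ a → (W a ≡ 1ℤ) × ((d ⊕ 𝟏) ≤P a)) n e × b¹≡ (M W d) n) ×
    -- (4): H¹ has basis the images of (e_{a₁}, 0), a₁ ≥ d₁ + 1, π(a₁) ≥ d₂ + 1
    (∀ d → ∃[ n ] Σ (Fin n → ℤ) λ e →
        Enumerates (λ a₁ → ((proj₁ d +ℤ 1ℤ) ≤ℤ a₁) × ((proj₂ d +ℤ 1ℤ) ≤ℤ π a₁)) n e ×
        IsH¹Basis (M W d) n (λ i → h¹vec W d (e i))) ×
    -- b⁰ vanishes for deg d small, b¹ vanishes for deg d large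
    (∃[ a ] (∀ d → deg d ≤ℤ a → b⁰≡ (M W d) 0)) ×
    (∃[ b ] (∀ d → b ≤ℤ deg d → b¹≡ (M W d) 0)) ×
    -- C = χ(M_{W,0}), χ(M_{W,d}) = deg d + C, and the duality formulas
    (∃[ C ] ((∃[ n₀ ] ∃[ n₁ ] (b⁰≡ (M W 𝟎) n₀ × b¹≡ (M W 𝟎) n₁ × C ≡ (+ n₀ -ℤ + n₁))) ×
             (∀ d n₀ n₁ → b⁰≡ (M W d) n₀ → b¹≡ (M W d) n₁ → (+ n₀ -ℤ + n₁) ≡ deg d +ℤ C) ×
             (∀ K d n₀ n₁ → b⁰≡ (M W (K ⊖ (K ⊖ d))) n₀ → b¹≡ (M W d) n₁ →
                + n₁ ≡ (+ n₀ -ℤ deg (K ⊖ (K ⊖ d))) -ℤ C) ×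
             (∀ K d n₁ → b¹≡ (M W d) n₁ → SumBelow (dual (K ⊕ 𝟏) W) (K ⊖ d) (+ n₁))))
theorem4p14 k W π pm =
  (λ d → let open H⁰ d in n , graph ∘ E , graph-enumerates , basis , (v , basis) ,
                          sumBelow-enumeration W d W≢0⇒W≡1 graph-enumerates) ,
  (λ d → let open H¹ d in n , graph ∘ E , graph-enumerates , (u , basis)) ,
  (λ d → let open H¹ d in n , E , e¹-enumerates d , basis) ,
  (a₀ , b⁰-vanishes) , (b₀ , b¹-vanishes) ,
  χ 𝟎 , (N⁰ 𝟎 , N¹ 𝟎 , (H⁰.v 𝟎 , H⁰.basis 𝟎) , (H¹.u 𝟎 , H¹.basis 𝟎) , refl) ,
  euler-characteristic , b¹-via-b⁰ , b¹-sumBelow-dual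
  where
  open PerfectMatching W π pm
  open CohomologyOfM k W π pm
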